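{- For any regular LK-proof $\pi$ of a sequent of prenex $\Sigma_1$ formulas in which all cuts are on prenex $\Pi_2$ or $\Sigma_2$ formulas, the language $L(\pi)$ is finite.
   Context: One-sided LK: formulas in negation normal form, $\bar A$ the dual, sequents finite sequences, $\lvert\Gamma\rvert$ the length. Axioms $\bar A,A$ ($A$ atomic); rules $\lor,\land,\forall$ (eigenvariable), $\exists$, cut, weakening, contraction, permutation. All formulas are prenex $\Pi_2$/$\Sigma_2$; regular means each strong quantifier inference has a unique eigenvariable. Types: $o$ = structured first-order terms (first-order terms closed under explicit substitution $s[\alpha\mapsto t]$), $\epsilon$ unit type with element $\langle\rangle$; closed under $\times$ (pairs $u\star u'$) and $\to$. $o^0=\epsilon$, $o^{k+1}=o\times o^k$, $\langle u_0,\dots,u_{k-1}\rangle=u_0\star\cdots\star u_{k-1}\star\langle\rangle$. For $F=\forall^m\exists^n G$ ($G$ quantifier-free): $\tau_F=o^n,\tau^*_F=o^m$; for $F=\exists^m\forall^nG$, $n>0$: $\tau_F=o^m$, $\tau^*_F=o\to\cdots\to o\to o^n$ ($m$ arguments). Grammar: for each subproof $\rho\vdash A_0,\dots,A_n$ and $i\le n$ a non-terminal $\sigma^i_\rho:\tau^*_{A_0}\to\cdots\to\tau^*_{A_n}\to\tau_{A_i}$, with production rules by the last inference of $\rho$: axiom $\rho\vdash\bar A,A$: $\sigma^i_\rho z_0z_1\to z_{1-i}$. $\forall$ ($\rho\vdash\forall vA,\Gamma$ from $\rho_0\vdash A(v/\alpha),\Gamma$): $\sigma^i_\rho(z_0\star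 z_1)\vec y\to(\sigma^i_{\rho_0}z_1\vec y)[\alpha\mapsto z_0]$. $\exists$ ($\rho\vdash\exists vA,\Gamma$ from $\rho_0\vdash A(v/r),\Gamma$): $\sigma^0_\rho z\vec y\to r\star\sigma^0_{\rho_0}(z\cdot r)\vec y$, $\sigma^i_\rho z\vec y\to\sigma^i_{\rho_0}(z\cdot r)\vec y$ ($i>0$), with $z\cdot r=z$ if $z:\epsilon$, else $zr$. Cut ($\rho\vdash\Gamma,\Delta$ from $\rho_0\vdash A,\Gamma$, $\rho_1\vdash\bar A,\Delta$; $\vec x,\vec y$ of lengths $\lvert\Gamma\rvert,\lvert\Delta\rvert$): $\sigma^i_\rho\vec x\vec y\to\sigma^{i+1}_{\rho_0}((\sigma^0_{\rho_1}\circ_{\bar A}\sigma^0_{\rho_0})\vec y\vec x)\vec x$ for $i<\lvert\Gamma\rvert$, and $\sigma^i_\rho\vec x\vec y\to\sigma^{i-\lvert\Gamma\rvert+1}_{\rho_1}((\sigma^0_{\rho_0}\circ_A\sigma^0_{\rho_1})\vec x\vec y)\vec y$ otherwise; where for $\theta_0\vdash F,\Gamma'$, $\theta_1\vdash\bar F,\Delta'$, $(\sigma^0_{\theta_0}\circ_F\sigma^0_{\theta_1})\vec x\vec y$ equals $\langle\rangle$ ($F$ quantifier-free), $\lambda z_0\cdots z_m.\sigma^0_{\theta_0}\langle z_0..z_m\rangle\vec x$ ($F=\forall v_0\cdots\forall v_mG$, $G\in\Sigma_1$), or $\sigma^0_{\theta_0}(\lambda z_0\cdots z_m.\sigma^0_{\theta_1}\langle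 z_0..z_m\rangle\vec y)\vec x$ ($F=\exists v_0\cdots\exists v_mG$, $G\in\Pi_1$). Contraction ($\rho\vdash A,\Gamma$ from $\rho_0\vdash A,A,\Gamma$): $\sigma^0_\rho z\vec y\to\sigma^0_{\rho_0}zz\vec y\mid\sigma^1_{\rho_0}zz\vec y$, $\sigma^i_\rho z\vec y\to\sigma^{i+1}_{\rho_0}zz\vec y$ ($i>0$). Weakening ($\rho\vdash A,\Gamma$ from $\rho_0\vdash\Gamma$): $\sigma^0_\rho z\vec y\to\langle\mathsf c,\dots,\mathsf c\rangle$ (one fixed constant per existential quantifier of $A$), $\sigma^i_\rho z\vec y\to\sigma^{i-1}_{\rho_0}\vec y$. Permutation ($\rho\vdash\Gamma,A,B,\Delta$ from $\rho_0\vdash\Gamma,B,A,\Delta$): $\sigma^i_\rho\vec xz_0z_1\vec y\to\sigma^j_{\rho_0}\vec xz_1z_0\vec y$, $j$ the index of the $i$-th formula after swapping. Language: derivations apply production rules and $\beta$-reductions. For $\pi\vdash\exists\vec v_0A_0,\dots,\exists\vec v_kA_k$ ($A_i$ quantifier-free, $\exists\vec v_i$ a block of length $a_i$), $L(\pi)$ is the set of pairs $(i,T^*)$, $i\le k$, where $T:o^{a_i}$ is a non-terminal-free sequence-term derivable from $\sigma^i_\pi\langle\rangle\cdots\langle\rangle$ and $T^*$ is the result of evaluating all explicit substitutions in $T$. -}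

module Defs where

open import Data.Nat using (ℕ; zero; suc; _+_; _∸_; _<_; _<ᵇ_; _≡ᵇ_; pred)
open import Data.Fin using (Fin; zero; suc)
open import Data.Bool using (Bool; true; false; not; if_then_else_; _∧_)
open import Data.List using (List; []; _∷_; _++_; length; replicate; foldr; map; concatMap)
open import Data.Maybe using (Maybe; just; nothing; _>>=_)
open import Data.Product using (Σ; _×_; _,_; ∃-syntax)
open import Data.Sum using (_⊎_)
open import Data.List.Membership.Propositional using (_∈_; _∉_)
open import Data.List.Relation.Unary.Unique.Propositional using (Unique)
open import Relation.Binary.PropositionalEquality using (_≡_)
open import Relation.Binary.Construct.Closure.ReflexiveTransitive using (Star)

-- First-order terms over a signature with function symbols ℕ (any arity).
-- Bound variables are well-scoped de Bruijn indices (Fin n); free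
-- variables (including eigenvariables α) are named by ℕ.

data BT (n : ℕ) : Set where
  bv : Fin n → BT n
  fv : ℕ → BT n
  fn : ℕ → List (BT n) → BT n

Term : Set
Term = BT 0

mutual
  substB : ∀ {m n} → (Fin m → BT n) → BT m → BT n
  substB σ (bv i)    = σ i
  substB σ (fv x)    = fv x
  substB σ (fn f ts) = fn f (substBs σ ts)

  substBs : ∀ {m n} → (Fin m → BT n) → List (BT m) → List (BT n)
  substBs σ []       = []
  substBs σ (t ∷ ts) = substB σ t ∷ substBs σ ts

weakB : ∀ {n} → BT n → BT (suc n)
weakB = substB (λ i → bv (suc i))

mutual
  substFV : ℕ → Term → Term → Term
  substFV α s (bv ())
  substFV α s (fv x)    = if x ≡ᵇ α then s else fv x
  substFV α s (fn f ts) = fn f (substFVs α s ts)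

  substFVs : ℕ → Term → List Term → List Term
  substFVs α s []       = []
  substFVs α s (t ∷ ts) = substFV α s t ∷ substFVs α s ts

mutual
  fvB : ∀ {n} → BT n → List ℕ
  fvB (bv i)    = []
  fvB (fv x)    = x ∷ []
  fvB (fn f ts) = fvBs ts

  fvBs : ∀ {n} → List (BT n) → List ℕ
  fvBs []       = []
  fvBs (t ∷ ts) = fvB t ++ fvBs ts

-- Formulas in negation normal form; lit true P ts = P(ts), lit false = ¬P(ts)

data Fm (n : ℕ) : Set where
  lit  : Bool → ℕ → List (BT n) → Fm n
  _∧'_ : Fm n → Fm n → Fm n
  _∨'_ : Fm n → Fm n → Fm n
  ∀'   : Fm (suc n) → Fm n
  ∃'   : Fm (suc n) → Fm n

Formula : Set
Formula = Fm 0

Seq : Set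
Seq = List Formula

dual : ∀ {n} → Fm n → Fm n
dual (lit b P ts) = lit (not b) P ts
dual (A ∧' B)     = dual A ∨' dual B
dual (A ∨' B)     = dual A ∧' dual B
dual (∀' A)       = ∃' (dual A)
dual (∃' A)       = ∀' (dual A)

extS : ∀ {m n} → (Fin m → BT n) → Fin (suc m) → BT (suc n)
extS σ zero    = bv zero
extS σ (suc i) = weakB (σ i)

substF : ∀ {m n} → (Fin m → BT n) → Fm m → Fm n
substF σ (lit b P ts) = lit b P (substBs σ ts)
substF σ (A ∧' B)     = substF σ A ∧' substF σ B
substF σ (A ∨' B)     = substF σ A ∨' substF σ B
substF σ (∀' A)       = ∀' (substF (extS σ) A)
substF σ (∃' A)       = ∃' (substF (extS σ) A)

-- A(v/t) for the body A of  ∀v A  or  ∃v A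
inst : Fm 1 → Term → Formula
inst A t = substF (λ { zero → t }) A

fvF : ∀ {n} → Fm n → List ℕ
fvF (lit b P ts) = fvBs ts
fvF (A ∧' B)     = fvF A ++ fvF B
fvF (A ∨' B)     = fvF A ++ fvF B
fvF (∀' A)       = fvF A
fvF (∃' A)       = fvF A

fvS : Seq → List ℕ
fvS = concatMap fvF

data QF {n} : Fm n → Set where
  qlit : ∀ {b P ts} → QF (lit b P ts)
  qand : ∀ {A B} → QF A → QF B → QF (A ∧' B)
  qor  : ∀ {A B} → QF A → QF B → QF (A ∨' B)

data IsΣ1 {n} : Fm n → Set where
  s1qf : ∀ {A} → QF A → IsΣ1 A
  s1ex : ∀ {A} → IsΣ1 A → IsΣ1 (∃' A)

data IsΠ1 {n} : Fm n → Set where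
  p1qf  : ∀ {A} → QF A → IsΠ1 A
  p1all : ∀ {A} → IsΠ1 A → IsΠ1 (∀' A)

data IsΠ2 {n} : Fm n → Set where
  p2s1  : ∀ {A} → IsΣ1 A → IsΠ2 A
  p2all : ∀ {A} → IsΠ2 A → IsΠ2 (∀' A)

data IsΣ2 {n} : Fm n → Set where
  s2p1 : ∀ {A} → IsΠ1 A → IsΣ2 A
  s2ex : ∀ {A} → IsΣ2 A → IsΣ2 (∃' A)

-- One-sided LK (principal formula in front; permutation swaps neighbours)

data Proof : Seq → Set where
  ax    : (b : Bool) (P : ℕ) (ts : List Term) →
          Proof (lit (not b) P ts ∷ lit b P ts ∷ [])
  orR   : ∀ {A B Γ} → Proof (A ∷ B ∷ Γ) → Proof ((A ∨' B) ∷ Γ)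
  andR  : ∀ {A B Γ Δ} → Proof (A ∷ Γ) → Proof (B ∷ Δ) →
          Proof ((A ∧' B) ∷ Γ ++ Δ)
  allR  : ∀ {Γ} (A : Fm 1) (α : ℕ) → α ∉ fvS (∀' A ∷ Γ) →
          Proof (inst A (fv α) ∷ Γ) → Proof (∀' A ∷ Γ)
  exR   : ∀ {Γ} (A : Fm 1) (r : Term) →
          Proof (inst A r ∷ Γ) → Proof (∃' A ∷ Γ)
  cut   : ∀ {Γ Δ} (A : Formula) → Proof (A ∷ Γ) → Proof (dual A ∷ Δ) →
          Proof (Γ ++ Δ)
  weak  : ∀ {Γ} (A : Formula) → Proof Γ → Proof (A ∷ Γ)
  contr : ∀ {A Γ} → Proof (A ∷ A ∷ Γ) → Proof (A ∷ Γ)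
  perm  : ∀ {A B Δ} (Γ : Seq) → Proof (Γ ++ B ∷ A ∷ Δ) →
          Proof (Γ ++ A ∷ B ∷ Δ)

eigenvars : ∀ {Γ} → Proof Γ → List ℕ
eigenvars (ax b P ts)     = []
eigenvars (orR ρ)         = eigenvars ρ
eigenvars (andR ρ ρ₁)     = eigenvars ρ ++ eigenvars ρ₁
eigenvars (allR A α _ ρ)  = α ∷ eigenvars ρ
eigenvars (exR A r ρ)     = eigenvars ρ
eigenvars (cut A ρ ρ₁)    = eigenvars ρ ++ eigenvars ρ₁
eigenvars (weak A ρ)      = eigenvars ρ
eigenvars (contr ρ)       = eigenvars ρ
eigenvars (perm Γ ρ)      = eigenvars ρ

Regular : ∀ {Γ} → Proof Γ → Set
Regular π = Unique (eigenvars π)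

cutFormulas : ∀ {Γ} → Proof Γ → List Formula
cutFormulas (ax b P ts)     = []
cutFormulas (orR ρ)         = cutFormulas ρ
cutFormulas (andR ρ ρ₁)     = cutFormulas ρ ++ cutFormulas ρ₁
cutFormulas (allR A α _ ρ)  = cutFormulas ρ
cutFormulas (exR A r ρ)     = cutFormulas ρ
cutFormulas (cut A ρ ρ₁)    = A ∷ cutFormulas ρ ++ cutFormulas ρ₁
cutFormulas (weak A ρ)      = cutFormulas ρ
cutFormulas (contr ρ)       = cutFormulas ρ
cutFormulas (perm Γ ρ)      = cutFormulas ρ

-- Subproof occurrences, addressed by paths (child indices from the root)

Path : Set
Path = List ℕ

subproof : ∀ {Γ} → Proof Γ → Path → Maybe (Σ Seq Proof)
subproof {Γ} ρ []               = just (Γ , ρ)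
subproof (orR ρ)        (0 ∷ p) = subproof ρ p
subproof (andR ρ ρ₁)    (0 ∷ p) = subproof ρ p
subproof (andR ρ ρ₁)    (1 ∷ p) = subproof ρ₁ p
subproof (allR A α _ ρ) (0 ∷ p) = subproof ρ p
subproof (exR A r ρ)    (0 ∷ p) = subproof ρ p
subproof (cut A ρ ρ₁)   (0 ∷ p) = subproof ρ p
subproof (cut A ρ ρ₁)   (1 ∷ p) = subproof ρ₁ p
subproof (weak A ρ)     (0 ∷ p) = subproof ρ p
subproof (contr ρ)      (0 ∷ p) = subproof ρ p
subproof (perm Γ ρ)     (0 ∷ p) = subproof ρ p
subproof _              _       = nothing

-- Terms of the grammar: untyped λ-terms (de Bruijn) with pairs u ⋆ u',
-- unit ⟨⟩, first-order terms, explicit substitutions s[α ↦ t], and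
-- non-terminals σ^i_ρ  (named by the path of ρ and i).

NT : Set
NT = Path × ℕ

data Tm : Set where
  var  : ℕ → Tm
  lam  : Tm → Tm
  app  : Tm → Tm → Tm
  nt   : NT → Tm
  unit : Tm
  pair : Tm → Tm → Tm
  trm  : Term → Tm
  esub : Tm → ℕ → Tm → Tm

shiftFrom : ℕ → ℕ → Tm → Tm
shiftFrom c d (var x)      = if x <ᵇ c then var x else var (x + d)
shiftFrom c d (lam t)      = lam (shiftFrom (suc c) d t)
shiftFrom c d (app t u)    = app (shiftFrom c d t) (shiftFrom c d u)
shiftFrom c d (nt a)       = nt a
shiftFrom c d unit         = unit
shiftFrom c d (pair t u)   = pair (shiftFrom c d t) (shiftFrom c d u)
shiftFrom c d (trm r)      = trm r
shiftFrom c d (esub t α u) = esub (shiftFrom c d t) α (shiftFrom c d u)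

shift : ℕ → Tm → Tm
shift = shiftFrom 0

-- t[k := u]  (capture-avoiding, de Bruijn; variables above k decremented)
substAt : ℕ → Tm → Tm → Tm
substAt k u (var x)      = if x ≡ᵇ k then shift k u
                           else (if k <ᵇ x then var (pred x) else var x)
substAt k u (lam t)      = lam (substAt (suc k) u t)
substAt k u (app t t₁)   = app (substAt k u t) (substAt k u t₁)
substAt k u (nt a)       = nt a
substAt k u unit         = unit
substAt k u (pair t t₁)  = pair (substAt k u t) (substAt k u t₁)
substAt k u (trm r)      = trm r
substAt k u (esub t α v) = esub (substAt k u t) α (substAt k u v)

apps : Tm → List Tm → Tm
apps t []       = t
apps t (u ∷ us) = apps (app t u) us

lams : ℕ → Tm → Tm
lams zero    t = t
lams (suc k) t = lam (lams k t)

tuple : List Tm → Tm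
tuple = foldr pair unit

-- under λz₀⋯λz_{k-1}: the list  z₀ … z_{k-1}
boundVars : ℕ → List Tm
boundVars zero    = []
boundVars (suc k) = var k ∷ boundVars k

qfb : ∀ {n} → Fm n → Bool
qfb (lit b P ts) = true
qfb (A ∧' B)     = qfb A ∧ qfb B
qfb (A ∨' B)     = qfb A ∧ qfb B
qfb (∀' A)       = false
qfb (∃' A)       = false

-- is the formula prenex Σ₁ (then τ* = ε)
isΣ1b : ∀ {n} → Fm n → Bool
isΣ1b (∃' A) = isΣ1b A
isΣ1b A      = qfb A

dotr : Formula → Tm → Term → Tm
dotr F z r = if isΣ1b F then z else app z (trm r)

nExists : ∀ {n} → Fm n → ℕ
nExists (lit b P ts) = 0
nExists (A ∧' B)     = nExists A + nExists B
nExists (A ∨' B)     = nExists A + nExists B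
nExists (∀' A)       = nExists A
nExists (∃' A)       = suc (nExists A)

-- the four cases of  (σ⁰_θ₀ ∘_F σ⁰_θ₁) x⃗ y⃗ , chosen by the shape of F:
--   cUnit      : F quantifier-free or prenex Π₁ with ≥1 ∀         ↦ ⟨⟩
--   cLam k     : F = ∀^k ∃… G, k ≥ 1                             ↦ λz⃗.σ⁰_θ₀⟨z⃗⟩x⃗
--   cApp k     : F = ∃^k ∀… G, k ≥ 1                             ↦ σ⁰_θ₀(λz⃗.σ⁰_θ₁⟨z⃗⟩y⃗)x⃗
--   cAppUnit k : F = ∃^k G, G quantifier-free (τ*_F = ε)          ↦ σ⁰_θ₀⟨⟩x⃗
data CutShape : Set where
  cUnit    : CutShape
  cLam     : ℕ → CutShape
  cApp     : ℕ → CutShape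
  cAppUnit : ℕ → CutShape

shapeAll : ∀ {n} → ℕ → Fm n → CutShape
shapeAll k (∀' A) = shapeAll (suc k) A
shapeAll k (∃' A) = cLam k
shapeAll k _      = cUnit

shapeEx : ∀ {n} → ℕ → Fm n → CutShape
shapeEx k (∃' A) = shapeEx (suc k) A
shapeEx k (∀' A) = cApp k
shapeEx k _      = cAppUnit k

cutShape : Formula → CutShape
cutShape (∀' A) = shapeAll 1 A
cutShape (∃' A) = shapeEx 1 A
cutShape _      = cUnit

compose : Formula → Path → Path → List Tm → List Tm → Tm
compose F p₀ p₁ xs ys with cutShape F
... | cUnit      = unit
... | cLam k     = lams k (apps (nt (p₀ , 0)) (tuple (boundVars k) ∷ map (shift k) xs))
... | cApp k     = apps (nt (p₀ , 0))
                     (lams k (apps (nt (p₁ , 0)) (tuple (boundVars k) ∷ map (shift k) ys)) ∷ xs)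
... | cAppUnit k = apps (nt (p₀ , 0)) (unit ∷ xs)

child : Path → ℕ → Path
child p k = p ++ k ∷ []

σc : Path → ℕ → ℕ → List Tm → Tm
σc p k i args = apps (nt (child p k , i)) args

swapAt : ℕ → List Tm → List Tm
swapAt zero    (a ∷ b ∷ r) = b ∷ a ∷ r
swapAt (suc k) (a ∷ r)     = a ∷ swapAt k r
swapAt _       l           = l

swapIdx : ℕ → ℕ → ℕ
swapIdx k i = if i ≡ᵇ k then suc k else (if i ≡ᵇ suc k then k else i)

-- Production rules of the last inference of ρ (ρ located at path p):
-- RootRule ρ p i args rhs  means   σ^i_ρ args → rhs

data RootRule (c : ℕ) : ∀ {Γ} → Proof Γ → Path → ℕ → List Tm → Tm → Set where
  r-ax0 : ∀ {b P ts p z₀ z₁} →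
          RootRule c (ax b P ts) p 0 (z₀ ∷ z₁ ∷ []) z₁
  r-ax1 : ∀ {b P ts p z₀ z₁} →
          RootRule c (ax b P ts) p 1 (z₀ ∷ z₁ ∷ []) z₀
  r-or0 : ∀ {A B Γ} {ρ : Proof (A ∷ B ∷ Γ)} {p z ys} → length ys ≡ length Γ →
          RootRule c (orR ρ) p 0 (z ∷ ys) unit
  r-orS : ∀ {A B Γ} {ρ : Proof (A ∷ B ∷ Γ)} {p z ys i} → length ys ≡ length Γ →
          i < length Γ →
          RootRule c (orR ρ) p (suc i) (z ∷ ys) (σc p 0 (suc (suc i)) (unit ∷ unit ∷ ys))
  r-and0 : ∀ {A B Γ Δ} {ρ₀ : Proof (A ∷ Γ)} {ρ₁ : Proof (B ∷ Δ)} {p z xs ys} →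
          length xs ≡ length Γ → length ys ≡ length Δ →
          RootRule c (andR ρ₀ ρ₁) p 0 (z ∷ xs ++ ys) unit
  r-andL : ∀ {A B Γ Δ} {ρ₀ : Proof (A ∷ Γ)} {ρ₁ : Proof (B ∷ Δ)} {p z xs ys i} →
          length xs ≡ length Γ → length ys ≡ length Δ → i < length Γ →
          RootRule c (andR ρ₀ ρ₁) p (suc i) (z ∷ xs ++ ys) (σc p 0 (suc i) (unit ∷ xs))
  r-andR : ∀ {A B Γ Δ} {ρ₀ : Proof (A ∷ Γ)} {ρ₁ : Proof (B ∷ Δ)} {p z xs ys i} →
          length xs ≡ length Γ → length ys ≡ length Δ → i < length Δ →
          RootRule c (andR ρ₀ ρ₁) p (suc (length Γ + i)) (z ∷ xs ++ ys)
            (σc p 1 (suc i) (unit ∷ ys))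
  r-all : ∀ {Γ A α nf} {ρ : Proof (inst A (fv α) ∷ Γ)} {p z₀ z₁ ys i} →
          length ys ≡ length Γ → i < suc (length Γ) →
          RootRule c (allR A α nf ρ) p i (pair z₀ z₁ ∷ ys) (esub (σc p 0 i (z₁ ∷ ys)) α z₀)
  r-ex0 : ∀ {Γ A r} {ρ : Proof (inst A r ∷ Γ)} {p z ys} →
          length ys ≡ length Γ →
          RootRule c (exR A r ρ) p 0 (z ∷ ys)
            (pair (trm r) (σc p 0 0 (dotr (∃' A) z r ∷ ys)))
  r-exS : ∀ {Γ A r} {ρ : Proof (inst A r ∷ Γ)} {p z ys i} →
          length ys ≡ length Γ → i < length Γ →
          RootRule c (exR A r ρ) p (suc i) (z ∷ ys) (σc p 0 (suc i) (dotr (∃' A) z r ∷ ys))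
  r-cutL : ∀ {Γ Δ A} {ρ₀ : Proof (A ∷ Γ)} {ρ₁ : Proof (dual A ∷ Δ)} {p xs ys i} →
          length xs ≡ length Γ → length ys ≡ length Δ → i < length Γ →
          RootRule c (cut A ρ₀ ρ₁) p i (xs ++ ys)
            (σc p 0 (suc i) (compose (dual A) (child p 1) (child p 0) ys xs ∷ xs))
  r-cutR : ∀ {Γ Δ A} {ρ₀ : Proof (A ∷ Γ)} {ρ₁ : Proof (dual A ∷ Δ)} {p xs ys i} →
          length xs ≡ length Γ → length ys ≡ length Δ → i < length Δ →
          RootRule c (cut A ρ₀ ρ₁) p (length Γ + i) (xs ++ ys)
            (σc p 1 (suc i) (compose A (child p 0) (child p 1) xs ys ∷ ys))
  r-w0  : ∀ {Γ A} {ρ : Proof Γ} {p z ys} → length ys ≡ length Γ →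
          RootRule c (weak A ρ) p 0 (z ∷ ys) (tuple (replicate (nExists A) (trm (fn c []))))
  r-wS  : ∀ {Γ A} {ρ : Proof Γ} {p z ys i} → length ys ≡ length Γ → i < length Γ →
          RootRule c (weak A ρ) p (suc i) (z ∷ ys) (σc p 0 i ys)
  r-c00 : ∀ {A Γ} {ρ : Proof (A ∷ A ∷ Γ)} {p z ys} → length ys ≡ length Γ →
          RootRule c (contr ρ) p 0 (z ∷ ys) (σc p 0 0 (z ∷ z ∷ ys))
  r-c01 : ∀ {A Γ} {ρ : Proof (A ∷ A ∷ Γ)} {p z ys} → length ys ≡ length Γ →
          RootRule c (contr ρ) p 0 (z ∷ ys) (σc p 0 1 (z ∷ z ∷ ys))
  r-cS  : ∀ {A Γ} {ρ : Proof (A ∷ A ∷ Γ)} {p z ys i} → length ys ≡ length Γ →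
          i < length Γ →
          RootRule c (contr ρ) p (suc i) (z ∷ ys) (σc p 0 (suc (suc i)) (z ∷ z ∷ ys))
  r-perm : ∀ {A B Δ Γ} {ρ : Proof (Γ ++ B ∷ A ∷ Δ)} {p args i} →
          length args ≡ length (Γ ++ A ∷ B ∷ Δ) → i < length args →
          RootRule c (perm Γ ρ) p i args
            (σc p 0 (swapIdx (length Γ) i) (swapAt (length Γ) args))

Prod : ∀ {Γ} → ℕ → Proof Γ → Tm → Tm → Set
Prod c π l r = ∃[ p ] ∃[ Δ ] ∃[ ρ ] ∃[ i ] ∃[ args ]
  (subproof π p ≡ just (Δ , ρ) × RootRule c ρ p i args r × l ≡ apps (nt (p , i)) args)

data Step {Γ} (c : ℕ) (π : Proof Γ) : Tm → Tm → Set where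
  prod  : ∀ {l r} → Prod c π l r → Step c π l r
  beta  : ∀ {t u} → Step c π (app (lam t) u) (substAt 0 u t)
  lamS  : ∀ {t t'} → Step c π t t' → Step c π (lam t) (lam t')
  appL  : ∀ {t t' u} → Step c π t t' → Step c π (app t u) (app t' u)
  appR  : ∀ {t u u'} → Step c π u u' → Step c π (app t u) (app t u')
  pairL : ∀ {t t' u} → Step c π t t' → Step c π (pair t u) (pair t' u)
  pairR : ∀ {t u u'} → Step c π u u' → Step c π (pair t u) (pair t u')
  esubL : ∀ {t t' α u} → Step c π t t' → Step c π (esub t α u) (esub t' α u)
  esubR : ∀ {t α u u'} → Step c π u u' → Step c π (esub t α u) (esub t α u')

Derives : ∀ {Γ} → ℕ → Proof Γ → Tm → Tm → Set
Derives c π = Star (Step c π)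

-- Evaluation T ↦ T* of the explicit substitutions in a (non-terminal-free)
-- sequence-term; fails (nothing) on anything that is not such a term.

evalO : Tm → Maybe Term
evalO (trm r)      = just r
evalO (esub t α u) = evalO t >>= λ s → evalO u >>= λ v → just (substFV α v s)
evalO _            = nothing

evalS : Tm → Maybe (List Term)
evalS unit         = just []
evalS (pair t u)   = evalO t >>= λ s → evalS u >>= λ ss → just (s ∷ ss)
evalS (esub t α u) = evalS t >>= λ ss → evalO u >>= λ v → just (substFVs α v ss)
evalS _            = nothing

-- L(π) (with weakening constant c):  (i , T*) ∈ L(π)
InL : ∀ {Γ} → ℕ → Proof Γ → ℕ × List Term → Set
InL {Γ} c π (i , ts) = i < length Γ ×
  ∃[ T ] (Derives c π (apps (nt ([] , i)) (replicate (length Γ) unit)) T × evalS T ≡ just ts)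

module Submission where

-- L(π) is finite, by abstract interpretation of the grammar of π.
--
-- Every argument of a non-terminal σ^i_ρ has a type τ*_A for a formula A of the
-- end-sequent of ρ.  Since the end-sequent of π is Σ₁ and all cut formulas are prenex
-- Π₂ or Σ₂, every formula in π is prenex Π₂/Σ₂, so each such τ*_A is a tuple type o^m
-- or a first-order function type o → ⋯ → o → o^n.  Hence the terms derivable from a
-- grammar term can be bounded by a sequence of finite sets of first-order terms
-- (Approx), and functions of first-order arguments by maps between such sequences
-- (ApproxFun).  The map  bound ρ  evaluates the production rules of the last
-- inference of ρ on these abstract values, by recursion on ρ; the main lemma
-- σ-bounded shows by induction on ρ that σ^i_ρ applied to bounded arguments is
-- bounded by  bound ρ .  Applied to the start symbols σ^i_π ⟨⟩ ⋯ ⟨⟩ this yields an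
-- explicit finite list containing L(π).

open import Defs
open import Data.Nat using (ℕ; zero; suc; _+_; _<_; _≤_; _<ᵇ_; _≡ᵇ_; pred; z≤n; s≤s; _<?_)
open import Data.Nat.Properties
open import Data.Bool using (true; false; T; if_then_else_; _∧_)
open import Data.Bool.Properties using (not-involutive)
open import Data.Fin using (Fin)
open import Data.Unit using (tt)
open import Data.Empty using (⊥-elim)
open import Data.List using (List; []; _∷_; _++_; map; length; replicate; take; drop; upTo; cartesianProduct; cartesianProductWith)
open import Data.List.Properties using (++-assoc; ++-identityʳ; map-id; map-∘; map-++; length-map; length-++; cartesianProductWith-zeroʳ)
open import Data.Product using (Σ; _×_; _,_; proj₁; proj₂; ∃-syntax)
open import Data.Sum using (_⊎_; inj₁; inj₂)
open import Data.List.Relation.Unary.All as All using (All; []; _∷_)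
open import Data.List.Relation.Unary.All.Properties using (++⁻ˡ; ++⁻ʳ)
open import Data.List.Membership.Propositional using (_∈_)
open import Data.List.Membership.Propositional.Properties using (∈-++⁺ˡ; ∈-++⁺ʳ; ∈-cartesianProductWith⁺; ∈-upTo⁺; ∈-cartesianProduct⁺)
open import Data.List.Relation.Unary.Any using (here; there)
open import Data.Maybe using (Maybe; just; nothing; _>>=_)
open import Relation.Binary.PropositionalEquality
open import Relation.Nullary using (yes; no)
open import Relation.Binary using (tri<; tri≈; tri>)
open import Relation.Binary.Construct.Closure.ReflexiveTransitive using (ε; _◅_; _◅◅_; gmap)
open import Data.List.Relation.Binary.Pointwise as Pointwise using (Pointwise; []; _∷_; Pointwise-length)
open import Function using (_∘_; const)

-- De Bruijn algebra of the grammar terms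

<ᵇ-true : ∀ {x c} → x < c → (x <ᵇ c) ≡ true
<ᵇ-true {x} {c} x<c with x <ᵇ c | <⇒<ᵇ x<c
... | true | _ = refl

<ᵇ-false : ∀ {x c} → c ≤ x → (x <ᵇ c) ≡ false
<ᵇ-false {x} {c} c≤x with x <ᵇ c in eq
... | false = refl
... | true  = ⊥-elim (<⇒≱ (<ᵇ⇒< x c (subst T (sym eq) tt)) c≤x)

≡ᵇ-refl : ∀ x → (x ≡ᵇ x) ≡ true
≡ᵇ-refl x with x ≡ᵇ x in eq
... | true  = refl
... | false = ⊥-elim (subst T eq (≡⇒≡ᵇ x x refl))

≡ᵇ-false : ∀ {x y} → x ≢ y → (x ≡ᵇ y) ≡ false
≡ᵇ-false {x} {y} x≢y with x ≡ᵇ y in eq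
... | false = refl
... | true  = ⊥-elim (x≢y (≡ᵇ⇒≡ x y (subst T (sym eq) tt)))

substAt-var-here : ∀ k u → substAt k u (var k) ≡ shift k u
substAt-var-here k u rewrite ≡ᵇ-refl k = refl

substAt-var-below : ∀ {x k} u → x < k → substAt k u (var x) ≡ var x
substAt-var-below {x} {k} u x<k
  rewrite ≡ᵇ-false {x} {k} (<⇒≢ x<k) | <ᵇ-false {k} {x} (<⇒≤ x<k) = refl

substAt-var-above : ∀ {x k} u → k < x → substAt k u (var x) ≡ var (pred x)
substAt-var-above {x} {k} u k<x
  rewrite ≡ᵇ-false {x} {k} (λ x≡k → <⇒≢ k<x (sym x≡k)) | <ᵇ-true k<x = refl

shift-var-below : ∀ {x c} d → x < c → shiftFrom c d (var x) ≡ var x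
shift-var-below d x<c rewrite <ᵇ-true x<c = refl

shift-var-above : ∀ {x c} d → c ≤ x → shiftFrom c d (var x) ≡ var (x + d)
shift-var-above d c≤x rewrite <ᵇ-false c≤x = refl

shift-zero : ∀ c t → shiftFrom c 0 t ≡ t
shift-zero c (var x) with x <ᵇ c
... | true  = refl
... | false = cong var (+-identityʳ x)
shift-zero c (lam t)      = cong lam (shift-zero (suc c) t)
shift-zero c (app t u)    = cong₂ app (shift-zero c t) (shift-zero c u)
shift-zero c (nt a)       = refl
shift-zero c unit         = refl
shift-zero c (pair t u)   = cong₂ pair (shift-zero c t) (shift-zero c u)
shift-zero c (trm r)      = refl
shift-zero c (esub t α u) = cong₂ (λ a b → esub a α b) (shift-zero c t) (shift-zero c u)

shift-shift : ∀ d c k n → c ≤ n → ∀ u →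
  shiftFrom (d + c) k (shiftFrom d n u) ≡ shiftFrom d (n + k) u
shift-shift d c k n c≤n (var x) with x <? d
... | yes x<d rewrite shift-var-below n x<d | shift-var-below {x} {d + c} k (≤-trans x<d (m≤m+n d c))
                    | shift-var-below (n + k) x<d = refl
... | no x≮d rewrite shift-var-above n (≮⇒≥ x≮d)
                   | shift-var-above {x + n} {d + c} k (+-mono-≤ (≮⇒≥ x≮d) c≤n)
                   | shift-var-above (n + k) (≮⇒≥ x≮d) = cong var (+-assoc x n k)
shift-shift d c k n c≤n (lam t)      = cong lam (shift-shift (suc d) c k n c≤n t)
shift-shift d c k n c≤n (app t u)    = cong₂ app (shift-shift d c k n c≤n t) (shift-shift d c k n c≤n u)
shift-shift d c k n c≤n (nt a)       = refl
shift-shift d c k n c≤n unit         = refl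
shift-shift d c k n c≤n (pair t u)   = cong₂ pair (shift-shift d c k n c≤n t) (shift-shift d c k n c≤n u)
shift-shift d c k n c≤n (trm r)      = refl
shift-shift d c k n c≤n (esub t α u) =
  cong₂ (λ a b → esub a α b) (shift-shift d c k n c≤n t) (shift-shift d c k n c≤n u)

substAt-shift-cancel : ∀ d c n → c ≤ n → ∀ w u →
  substAt (d + c) w (shiftFrom d (suc n) u) ≡ shiftFrom d n u
substAt-shift-cancel d c n c≤n w (var x) with x <? d
... | yes x<d rewrite shift-var-below (suc n) x<d | shift-var-below n x<d =
  substAt-var-below w (≤-trans x<d (m≤m+n d c))
... | no x≮d rewrite shift-var-above (suc n) (≮⇒≥ x≮d) | shift-var-above n (≮⇒≥ x≮d) =
  trans (substAt-var-above w (subst (d + c <_) (sym (+-suc x n)) (s≤s (+-mono-≤ (≮⇒≥ x≮d) c≤n))))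
        (cong (λ z → var (pred z)) (+-suc x n))
substAt-shift-cancel d c n c≤n w (lam t)   = cong lam (substAt-shift-cancel (suc d) c n c≤n w t)
substAt-shift-cancel d c n c≤n w (app t u) =
  cong₂ app (substAt-shift-cancel d c n c≤n w t) (substAt-shift-cancel d c n c≤n w u)
substAt-shift-cancel d c n c≤n w (nt a)     = refl
substAt-shift-cancel d c n c≤n w unit       = refl
substAt-shift-cancel d c n c≤n w (pair t u) =
  cong₂ pair (substAt-shift-cancel d c n c≤n w t) (substAt-shift-cancel d c n c≤n w u)
substAt-shift-cancel d c n c≤n w (trm r)    = refl
substAt-shift-cancel d c n c≤n w (esub t α u) =
  cong₂ (λ a b → esub a α b) (substAt-shift-cancel d c n c≤n w t) (substAt-shift-cancel d c n c≤n w u)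

private
  +-swap-right : ∀ c k j → c + k + j ≡ (c + j) + k
  +-swap-right c k j = trans (+-assoc c k j) (trans (cong (c +_) (+-comm k j)) (sym (+-assoc c j k)))

substAt-shift : ∀ c k j u x →
  substAt (c + k + j) u (shiftFrom c k x) ≡ shiftFrom c k (substAt (c + j) u x)
substAt-shift c k j u (var x) with x <? c
... | yes x<c rewrite shift-var-below k x<c | substAt-var-below {x} {c + j} u (≤-trans x<c (m≤m+n c j))
                    | shift-var-below k x<c =
  substAt-var-below u (≤-trans x<c (≤-trans (m≤m+n c k) (m≤m+n (c + k) j)))
... | no x≮c rewrite shift-var-above k (≮⇒≥ x≮c) with <-cmp x (c + j)
...   | tri< x<cj _ _ rewrite substAt-var-below {x} {c + j} u x<cj | shift-var-above k (≮⇒≥ x≮c) =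
        substAt-var-below u (subst (x + k <_) (sym (+-swap-right c k j)) (+-monoˡ-< k x<cj))
...   | tri≈ _ refl _ rewrite substAt-var-here (c + j) u | +-swap-right c k j | substAt-var-here (c + j + k) u =
        sym (shift-shift 0 c k (c + j) (m≤m+n c j) u)
...   | tri> _ _ cj<x with x
...     | zero = ⊥-elim (<⇒≱ cj<x z≤n)
...     | suc x' rewrite substAt-var-above {suc x'} {c + j} u cj<x
                       | shift-var-above k (≤-pred (≤-trans (s≤s (m≤m+n c j)) cj<x)) =
          substAt-var-above u (subst (_< suc x' + k) (sym (+-swap-right c k j)) (+-monoˡ-< k cj<x))
substAt-shift c k j u (lam t)    = cong lam (substAt-shift (suc c) k j u t)
substAt-shift c k j u (app t t') = cong₂ app (substAt-shift c k j u t) (substAt-shift c k j u t')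
substAt-shift c k j u (nt a)     = refl
substAt-shift c k j u unit       = refl
substAt-shift c k j u (pair t t') = cong₂ pair (substAt-shift c k j u t) (substAt-shift c k j u t')
substAt-shift c k j u (trm r)    = refl
substAt-shift c k j u (esub t α t') =
  cong₂ (λ a b → esub a α b) (substAt-shift c k j u t) (substAt-shift c k j u t')

substAt-substAt : ∀ c k u v t →
  substAt (c + k) u (substAt c v t) ≡ substAt c (substAt k u v) (substAt (suc (c + k)) u t)
substAt-substAt c k u v (var x) with <-cmp x c
... | tri< x<c _ _
  rewrite substAt-var-below v x<c | substAt-var-below {x} {c + k} u (≤-trans x<c (m≤m+n c k))
        | substAt-var-below {x} {suc (c + k)} u (≤-trans x<c (≤-trans (m≤m+n c k) (n≤1+n _)))
        | substAt-var-below (substAt k u v) x<c = refl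
... | tri≈ _ refl _
  rewrite substAt-var-here x v | substAt-var-below {x} {suc (x + k)} u (s≤s (m≤m+n x k))
        | substAt-var-here x (substAt k u v) = substAt-shift 0 x k u v
... | tri> _ _ c<x with x
...   | zero = ⊥-elim (<⇒≱ c<x z≤n)
...   | suc x' rewrite substAt-var-above {suc x'} {c} v c<x with <-cmp x' (c + k)
...     | tri< x'<ck _ _
          rewrite substAt-var-below {x'} {c + k} u x'<ck | substAt-var-below {suc x'} {suc (c + k)} u (s≤s x'<ck)
                | substAt-var-above {suc x'} {c} (substAt k u v) c<x = refl
...     | tri≈ _ refl _ rewrite substAt-var-here (c + k) u | substAt-var-here (suc (c + k)) u =
          sym (substAt-shift-cancel 0 c (c + k) (m≤m+n c k) (substAt k u v) u)
...     | tri> _ _ ck<x' with x'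
...       | zero = ⊥-elim (<⇒≱ ck<x' z≤n)
...       | suc x'' rewrite substAt-var-above {suc x''} {c + k} u ck<x'
                          | substAt-var-above {suc (suc x'')} {suc (c + k)} u (s≤s ck<x')
                          | substAt-var-above {suc x''} {c} (substAt k u v) (≤-trans (s≤s (m≤m+n c k)) ck<x') = refl
substAt-substAt c k u v (lam t)     = cong lam (substAt-substAt (suc c) k u v t)
substAt-substAt c k u v (app t t')  = cong₂ app (substAt-substAt c k u v t) (substAt-substAt c k u v t')
substAt-substAt c k u v (nt a)      = refl
substAt-substAt c k u v unit        = refl
substAt-substAt c k u v (pair t t') = cong₂ pair (substAt-substAt c k u v t) (substAt-substAt c k u v t')
substAt-substAt c k u v (trm r)     = refl
substAt-substAt c k u v (esub t α t') =
  cong₂ (λ a b → esub a α b) (substAt-substAt c k u v t) (substAt-substAt c k u v t')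

substAt-apps : ∀ k u h xs → substAt k u (apps h xs) ≡ apps (substAt k u h) (map (substAt k u) xs)
substAt-apps k u h []       = refl
substAt-apps k u h (x ∷ xs) = substAt-apps k u (app h x) xs

substAt-tuple : ∀ k u ts → substAt k u (tuple ts) ≡ tuple (map (substAt k u) ts)
substAt-tuple k u []       = refl
substAt-tuple k u (t ∷ ts) = cong (pair (substAt k u t)) (substAt-tuple k u ts)

substAt-lams : ∀ k j u t → substAt j u (lams k t) ≡ lams k (substAt (k + j) u t)
substAt-lams zero    j u t = refl
substAt-lams (suc k) j u t =
  cong lam (trans (substAt-lams k (suc j) u t) (cong (λ z → lams k (substAt z u t)) (+-suc k j)))

substAt-boundVars : ∀ m j u → m ≤ j → map (substAt j u) (boundVars m) ≡ boundVars m
substAt-boundVars zero    j u m≤j = refl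
substAt-boundVars (suc m) j u m≤j =
  cong₂ _∷_ (substAt-var-below u m≤j) (substAt-boundVars m j u (≤-trans (n≤1+n m) m≤j))

map-substAt-shift : ∀ k j u xs →
  map (substAt (k + j) u) (map (shift k) xs) ≡ map (shift k) (map (substAt j u) xs)
map-substAt-shift k j u []       = refl
map-substAt-shift k j u (x ∷ xs) = cong₂ _∷_ (substAt-shift 0 k j u x) (map-substAt-shift k j u xs)

substAt-compose : ∀ F p₀ p₁ j u xs ys → substAt j u (compose F p₀ p₁ xs ys)
  ≡ compose F p₀ p₁ (map (substAt j u) xs) (map (substAt j u) ys)
substAt-compose F p₀ p₁ j u xs ys with cutShape F
... | cUnit = refl
... | cLam k
  rewrite substAt-lams k j u (apps (nt (p₀ , 0)) (tuple (boundVars k) ∷ map (shift k) xs))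
        | substAt-apps (k + j) u (nt (p₀ , 0)) (tuple (boundVars k) ∷ map (shift k) xs)
        | substAt-tuple (k + j) u (boundVars k) | substAt-boundVars k (k + j) u (m≤m+n k j)
        | map-substAt-shift k j u xs = refl
... | cApp k
  rewrite substAt-apps j u (nt (p₀ , 0)) (lams k (apps (nt (p₁ , 0)) (tuple (boundVars k) ∷ map (shift k) ys)) ∷ xs)
        | substAt-lams k j u (apps (nt (p₁ , 0)) (tuple (boundVars k) ∷ map (shift k) ys))
        | substAt-apps (k + j) u (nt (p₁ , 0)) (tuple (boundVars k) ∷ map (shift k) ys)
        | substAt-tuple (k + j) u (boundVars k) | substAt-boundVars k (k + j) u (m≤m+n k j)
        | map-substAt-shift k j u ys = refl
... | cAppUnit k = substAt-apps j u (nt (p₀ , 0)) (unit ∷ xs)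

substAt-dotr : ∀ j u F z r → substAt j u (dotr F z r) ≡ dotr F (substAt j u z) r
substAt-dotr j u F z r with isΣ1b F
... | true  = refl
... | false = refl

map-swapAt : ∀ (f : Tm → Tm) n xs → map f (swapAt n xs) ≡ swapAt n (map f xs)
map-swapAt f zero    []           = refl
map-swapAt f zero    (x ∷ [])     = refl
map-swapAt f zero    (x ∷ y ∷ xs) = refl
map-swapAt f (suc n) []           = refl
map-swapAt f (suc n) (x ∷ xs)     = cong (f x ∷_) (map-swapAt f n xs)

substAt-constants : ∀ j u n x → map (substAt j u) (replicate n (trm x)) ≡ replicate n (trm x)
substAt-constants j u zero    x = refl
substAt-constants j u (suc n) x = cong (trm x ∷_) (substAt-constants j u n x)

-- Simultaneous substitution of  us  for the variables bound by  lams (length us) ;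
-- it is iterated β-reduction, used to reason about the λ-terms built at Π₂/Σ₂ cuts.

msubst : List Tm → Tm → Tm
msubst []       b = b
msubst (u ∷ us) b = msubst us (substAt (length us) u b)

msubst-apps : ∀ us h xs → msubst us (apps h xs) ≡ apps (msubst us h) (map (msubst us) xs)
msubst-apps []       h xs = cong (apps h) (sym (map-id xs))
msubst-apps (u ∷ us) h xs
  rewrite substAt-apps (length us) u h xs
        | msubst-apps us (substAt (length us) u h) (map (substAt (length us) u) xs) =
  cong (apps _) (sym (map-∘ xs))

msubst-nt : ∀ us a → msubst us (nt a) ≡ nt a
msubst-nt []       a = refl
msubst-nt (u ∷ us) a = msubst-nt us a

msubst-pair : ∀ us t t' → msubst us (pair t t') ≡ pair (msubst us t) (msubst us t')
msubst-pair []       t t' = refl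
msubst-pair (u ∷ us) t t' = msubst-pair us _ _

msubst-tuple : ∀ us ts → msubst us (tuple ts) ≡ tuple (map (msubst us) ts)
msubst-tuple []       []       = refl
msubst-tuple (u ∷ us) []       = msubst-tuple us []
msubst-tuple us       (t ∷ ts) = trans (msubst-pair us t (tuple ts)) (cong (pair _) (msubst-tuple us ts))

msubst-shift : ∀ us x → msubst us (shift (length us) x) ≡ x
msubst-shift []       x = shift-zero 0 x
msubst-shift (u ∷ us) x =
  trans (cong (msubst us) (substAt-shift-cancel 0 (length us) (length us) ≤-refl u x)) (msubst-shift us x)

msubst-boundVars : ∀ us → map (msubst us) (boundVars (length us)) ≡ us
msubst-boundVars []       = refl
msubst-boundVars (u ∷ us) = cong₂ _∷_
  (trans (cong (msubst us) (substAt-var-here (length us) u)) (msubst-shift us u))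
  (begin
    map (msubst (u ∷ us)) (boundVars (length us))
      ≡⟨ map-∘ (boundVars (length us)) ⟩
    map (msubst us) (map (substAt (length us) u) (boundVars (length us)))
      ≡⟨ cong (map (msubst us)) (substAt-boundVars (length us) (length us) u ≤-refl) ⟩
    map (msubst us) (boundVars (length us))
      ≡⟨ msubst-boundVars us ⟩
    us ∎)
  where open ≡-Reasoning

msubst-cut-body : ∀ us k a xs → length us ≡ k →
  msubst us (apps (nt a) (tuple (boundVars k) ∷ map (shift k) xs)) ≡ apps (nt a) (tuple us ∷ xs)
msubst-cut-body us k a xs refl
  rewrite msubst-apps us (nt a) (tuple (boundVars (length us)) ∷ map (shift (length us)) xs)
        | msubst-nt us a | msubst-tuple us (boundVars (length us)) | msubst-boundVars us =
  cong (λ z → apps (nt a) (tuple us ∷ z)) (map-msubst-shift xs)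
  where
    map-msubst-shift : ∀ xs → map (msubst us) (map (shift (length us)) xs) ≡ xs
    map-msubst-shift []       = refl
    map-msubst-shift (x ∷ xs) = cong₂ _∷_ (msubst-shift us x) (map-msubst-shift xs)

spine : Tm → Tm × List Tm
spine (app t u) = proj₁ (spine t) , proj₂ (spine t) ++ u ∷ []
spine t         = t , []

spine-apps : ∀ h xs → spine (apps h xs) ≡ (proj₁ (spine h) , proj₂ (spine h) ++ xs)
spine-apps h []       = cong (proj₁ (spine h) ,_) (sym (++-identityʳ (proj₂ (spine h))))
spine-apps h (x ∷ xs) =
  trans (spine-apps (app h x) xs) (cong (proj₁ (spine h) ,_) (++-assoc (proj₂ (spine h)) (x ∷ []) xs))

head-apps : ∀ h xs → proj₁ (spine (apps h xs)) ≡ proj₁ (spine h)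
head-apps h xs = cong proj₁ (spine-apps h xs)

-- Prenex formulas and the arity of their witness types

-- oArity A is the number of first-order arguments of τ*_A: it is m for a
-- prenex Σ₂ formula ∃^m ∀^n G with n > 0, and 0 for every other formula
-- (then τ*_A is a tuple of terms or ε).
oArity : ∀ {n} → Fm n → ℕ
oArity (∃' A)      = if isΣ1b A then 0 else suc (oArity A)
oArity (lit _ _ _) = 0
oArity (_ ∧' _)    = 0
oArity (_ ∨' _)    = 0
oArity (∀' _)      = 0

qfb-substF : ∀ {m n} (σ : Fin m → BT n) A → qfb (substF σ A) ≡ qfb A
qfb-substF σ (lit b P ts) = refl
qfb-substF σ (A ∧' B)     = cong₂ _∧_ (qfb-substF σ A) (qfb-substF σ B)
qfb-substF σ (A ∨' B)     = cong₂ _∧_ (qfb-substF σ A) (qfb-substF σ B)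
qfb-substF σ (∀' A)       = refl
qfb-substF σ (∃' A)       = refl

isΣ1b-substF : ∀ {m n} (σ : Fin m → BT n) A → isΣ1b (substF σ A) ≡ isΣ1b A
isΣ1b-substF σ (lit b P ts) = refl
isΣ1b-substF σ (A ∧' B)     = cong₂ _∧_ (qfb-substF σ A) (qfb-substF σ B)
isΣ1b-substF σ (A ∨' B)     = cong₂ _∧_ (qfb-substF σ A) (qfb-substF σ B)
isΣ1b-substF σ (∀' A)       = refl
isΣ1b-substF σ (∃' A)       = isΣ1b-substF (extS σ) A

oArity-substF : ∀ {m n} (σ : Fin m → BT n) A → oArity (substF σ A) ≡ oArity A
oArity-substF σ (lit b P ts) = refl
oArity-substF σ (A ∧' B)     = refl
oArity-substF σ (A ∨' B)     = refl
oArity-substF σ (∀' A)       = refl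
oArity-substF σ (∃' A) rewrite isΣ1b-substF (extS σ) A | oArity-substF (extS σ) A = refl

oArity-Σ1 : ∀ {n} (A : Fm n) → isΣ1b A ≡ true → oArity A ≡ 0
oArity-Σ1 (lit _ _ _) _ = refl
oArity-Σ1 (A ∧' B)    _ = refl
oArity-Σ1 (A ∨' B)    _ = refl
oArity-Σ1 (∀' A)      _ = refl
oArity-Σ1 (∃' A)      e rewrite e = refl

QF⇒qfb : ∀ {n} {A : Fm n} → QF A → qfb A ≡ true
QF⇒qfb qlit = refl
QF⇒qfb (qand a b) rewrite QF⇒qfb a | QF⇒qfb b = refl
QF⇒qfb (qor a b)  rewrite QF⇒qfb a | QF⇒qfb b = refl

IsΣ1⇒isΣ1b : ∀ {n} {A : Fm n} → IsΣ1 A → isΣ1b A ≡ true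
IsΣ1⇒isΣ1b (s1qf qlit)       = refl
IsΣ1⇒isΣ1b (s1qf (qand a b)) rewrite QF⇒qfb a | QF⇒qfb b = refl
IsΣ1⇒isΣ1b (s1qf (qor a b))  rewrite QF⇒qfb a | QF⇒qfb b = refl
IsΣ1⇒isΣ1b (s1ex h)          = IsΣ1⇒isΣ1b h

-- Π₂ formulas have witness type τ = o^n and counter-witness type τ* = o^m: no arguments.
oArity-Π2 : ∀ {n} {A : Fm n} → IsΠ2 A → oArity A ≡ 0
oArity-Π2 {A = A} (p2s1 h) = oArity-Σ1 A (IsΣ1⇒isΣ1b h)
oArity-Π2 (p2all h)        = refl

IsΠ1⇒IsΠ2 : ∀ {n} {A : Fm n} → IsΠ1 A → IsΠ2 A
IsΠ1⇒IsΠ2 (p1qf q)  = p2s1 (s1qf q)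
IsΠ1⇒IsΠ2 (p1all h) = p2all (IsΠ1⇒IsΠ2 h)

Prenex : ∀ {n} → Fm n → Set
Prenex A = IsΠ2 A ⊎ IsΣ2 A

QF-substF : ∀ {m n} (σ : Fin m → BT n) {A} → QF A → QF (substF σ A)
QF-substF σ qlit       = qlit
QF-substF σ (qand a b) = qand (QF-substF σ a) (QF-substF σ b)
QF-substF σ (qor a b)  = qor (QF-substF σ a) (QF-substF σ b)

IsΣ1-substF : ∀ {m n} (σ : Fin m → BT n) {A} → IsΣ1 A → IsΣ1 (substF σ A)
IsΣ1-substF σ (s1qf q) = s1qf (QF-substF σ q)
IsΣ1-substF σ (s1ex h) = s1ex (IsΣ1-substF (extS σ) h)

IsΠ1-substF : ∀ {m n} (σ : Fin m → BT n) {A} → IsΠ1 A → IsΠ1 (substF σ A)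
IsΠ1-substF σ (p1qf q)  = p1qf (QF-substF σ q)
IsΠ1-substF σ (p1all h) = p1all (IsΠ1-substF (extS σ) h)

IsΠ2-substF : ∀ {m n} (σ : Fin m → BT n) {A} → IsΠ2 A → IsΠ2 (substF σ A)
IsΠ2-substF σ (p2s1 h)  = p2s1 (IsΣ1-substF σ h)
IsΠ2-substF σ (p2all h) = p2all (IsΠ2-substF (extS σ) h)

IsΣ2-substF : ∀ {m n} (σ : Fin m → BT n) {A} → IsΣ2 A → IsΣ2 (substF σ A)
IsΣ2-substF σ (s2p1 h) = s2p1 (IsΠ1-substF σ h)
IsΣ2-substF σ (s2ex h) = s2ex (IsΣ2-substF (extS σ) h)

Prenex-substF : ∀ {m n} (σ : Fin m → BT n) {A} → Prenex A → Prenex (substF σ A)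
Prenex-substF σ (inj₁ h) = inj₁ (IsΠ2-substF σ h)
Prenex-substF σ (inj₂ h) = inj₂ (IsΣ2-substF σ h)

QF-dual : ∀ {n} {A : Fm n} → QF A → QF (dual A)
QF-dual qlit       = qlit
QF-dual (qand a b) = qor (QF-dual a) (QF-dual b)
QF-dual (qor a b)  = qand (QF-dual a) (QF-dual b)

IsΣ1-dual : ∀ {n} {A : Fm n} → IsΣ1 A → IsΠ1 (dual A)
IsΣ1-dual (s1qf q) = p1qf (QF-dual q)
IsΣ1-dual (s1ex h) = p1all (IsΣ1-dual h)

IsΠ1-dual : ∀ {n} {A : Fm n} → IsΠ1 A → IsΣ1 (dual A)
IsΠ1-dual (p1qf q)  = s1qf (QF-dual q)
IsΠ1-dual (p1all h) = s1ex (IsΠ1-dual h)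

IsΠ2-dual : ∀ {n} {A : Fm n} → IsΠ2 A → IsΣ2 (dual A)
IsΠ2-dual (p2s1 h)  = s2p1 (IsΣ1-dual h)
IsΠ2-dual (p2all h) = s2ex (IsΠ2-dual h)

IsΣ2-dual : ∀ {n} {A : Fm n} → IsΣ2 A → IsΠ2 (dual A)
IsΣ2-dual (s2p1 h) = p2s1 (IsΠ1-dual h)
IsΣ2-dual (s2ex h) = p2all (IsΣ2-dual h)

Prenex-dual : ∀ {n} {A : Fm n} → Prenex A → Prenex (dual A)
Prenex-dual (inj₁ h) = inj₂ (IsΠ2-dual h)
Prenex-dual (inj₂ h) = inj₁ (IsΣ2-dual h)

dual-involutive : ∀ {n} (A : Fm n) → dual (dual A) ≡ A
dual-involutive (lit b P ts) = cong (λ z → lit z P ts) (not-involutive b)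
dual-involutive (A ∧' B)     = cong₂ _∧'_ (dual-involutive A) (dual-involutive B)
dual-involutive (A ∨' B)     = cong₂ _∨'_ (dual-involutive A) (dual-involutive B)
dual-involutive (∀' A)       = cong ∀' (dual-involutive A)
dual-involutive (∃' A)       = cong ∃' (dual-involutive A)

QF⇒Prenex : ∀ {n} {A : Fm n} → QF A → Prenex A
QF⇒Prenex q = inj₁ (p2s1 (s1qf q))

Prenex-∨⁻ : ∀ {n} {A B : Fm n} → Prenex (A ∨' B) → Prenex A × Prenex B
Prenex-∨⁻ (inj₁ (p2s1 (s1qf (qor a b)))) = QF⇒Prenex a , QF⇒Prenex b
Prenex-∨⁻ (inj₂ (s2p1 (p1qf (qor a b)))) = QF⇒Prenex a , QF⇒Prenex b

Prenex-∧⁻ : ∀ {n} {A B : Fm n} → Prenex (A ∧' B) → Prenex A × Prenex B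
Prenex-∧⁻ (inj₁ (p2s1 (s1qf (qand a b)))) = QF⇒Prenex a , QF⇒Prenex b
Prenex-∧⁻ (inj₂ (s2p1 (p1qf (qand a b)))) = QF⇒Prenex a , QF⇒Prenex b

Prenex-∀⁻ : ∀ {A : Fm 1} → Prenex (∀' A) → IsΠ2 A
Prenex-∀⁻ (inj₁ (p2all h))          = h
Prenex-∀⁻ (inj₂ (s2p1 (p1all h)))   = IsΠ1⇒IsΠ2 h
Prenex-∀⁻ (inj₁ (p2s1 (s1qf ())))
Prenex-∀⁻ (inj₂ (s2p1 (p1qf ())))

Prenex-∃⁻ : ∀ {A : Fm 1} → Prenex (∃' A) → Prenex A
Prenex-∃⁻ (inj₁ (p2s1 (s1ex h))) = inj₁ (p2s1 h)
Prenex-∃⁻ (inj₂ (s2ex h))        = inj₂ h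
Prenex-∃⁻ (inj₂ (s2p1 (p1qf ())))
Prenex-∃⁻ (inj₁ (p2s1 (s1qf ())))

-- The shape of a cut formula determines the arities of both cut formulas:
-- the λ-abstraction  λz₀…z_{k-1}  built at a cut takes exactly oArity-many arguments.

private
  data AllShape : CutShape → Set where
    unitShape : AllShape cUnit
    lamShape  : ∀ k → AllShape (cLam k)

  data ExShape : CutShape → Set where
    appShape     : ∀ k → ExShape (cApp k)
    appUnitShape : ∀ k → ExShape (cAppUnit k)

  shapeAll-cases : ∀ {n} m (B : Fm n) → AllShape (shapeAll m B)
  shapeAll-cases m (lit _ _ _) = unitShape
  shapeAll-cases m (_ ∧' _)    = unitShape
  shapeAll-cases m (_ ∨' _)    = unitShape
  shapeAll-cases m (∀' B)      = shapeAll-cases (suc m) B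
  shapeAll-cases m (∃' B)      = lamShape m

  shapeEx-cases : ∀ {n} m (B : Fm n) → ExShape (shapeEx m B)
  shapeEx-cases m (lit _ _ _) = appUnitShape m
  shapeEx-cases m (_ ∧' _)    = appUnitShape m
  shapeEx-cases m (_ ∨' _)    = appUnitShape m
  shapeEx-cases m (∀' B)      = appShape m
  shapeEx-cases m (∃' B)      = shapeEx-cases (suc m) B

  shapeAll-lam : ∀ {n} m (B : Fm n) k → shapeAll m B ≡ cLam k →
    isΣ1b (dual B) ≡ false × k ≡ m + oArity (dual B)
  shapeAll-lam m (∀' B) k e with shapeAll-lam (suc m) B k e
  ... | notΣ1 , k≡ rewrite notΣ1 = refl , trans k≡ (sym (+-suc m (oArity (dual B))))
  shapeAll-lam m (∃' B) k refl = refl , sym (+-identityʳ m)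
  shapeAll-lam m (lit _ _ _) k ()
  shapeAll-lam m (_ ∧' _)    k ()
  shapeAll-lam m (_ ∨' _)    k ()

  shapeEx-app : ∀ {n} m (B : Fm n) k → shapeEx m B ≡ cApp k →
    isΣ1b B ≡ false × k ≡ m + oArity B
  shapeEx-app m (∃' B) k e with shapeEx-app (suc m) B k e
  ... | notΣ1 , k≡ rewrite notΣ1 = refl , trans k≡ (sym (+-suc m (oArity B)))
  shapeEx-app m (∀' B) k refl = refl , sym (+-identityʳ m)
  shapeEx-app m (lit _ _ _) k ()
  shapeEx-app m (_ ∧' _)    k ()
  shapeEx-app m (_ ∨' _)    k ()

cutShape-lam : ∀ (F : Formula) k → cutShape F ≡ cLam k → oArity F ≡ 0 × oArity (dual F) ≡ k
cutShape-lam (∀' B) k e with shapeAll-lam 1 B k e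
... | notΣ1 , k≡ rewrite notΣ1 = refl , sym k≡
cutShape-lam (∃' B) k e with shapeEx 1 B | shapeEx-cases 1 B | e
... | _ | appShape _     | ()
... | _ | appUnitShape _ | ()
cutShape-lam (lit _ _ _) k ()
cutShape-lam (_ ∧' _)    k ()
cutShape-lam (_ ∨' _)    k ()

cutShape-app : ∀ (F : Formula) k → cutShape F ≡ cApp k → oArity F ≡ k × oArity (dual F) ≡ 0
cutShape-app (∃' B) k e with shapeEx-app 1 B k e
... | notΣ1 , k≡ rewrite notΣ1 = sym k≡ , refl
cutShape-app (∀' B) k e with shapeAll 1 B | shapeAll-cases 1 B | e
... | _ | unitShape | ()
... | _ | lamShape _ | ()
cutShape-app (lit _ _ _) k ()
cutShape-app (_ ∧' _)    k ()
cutShape-app (_ ∨' _)    k ()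

cutShape-appUnit : ∀ (F : Formula) k → cutShape F ≡ cAppUnit k → oArity (dual F) ≡ 0
cutShape-appUnit (∃' B) k e = refl
cutShape-appUnit (∀' B) k e with shapeAll 1 B | shapeAll-cases 1 B | e
... | _ | unitShape  | ()
... | _ | lamShape _ | ()
cutShape-appUnit (lit _ _ _) k ()
cutShape-appUnit (_ ∧' _)    k ()
cutShape-appUnit (_ ∨' _)    k ()

subproof-++ : ∀ {Γ} (σ : Proof Γ) p q → subproof σ (p ++ q) ≡ (subproof σ p >>= λ x → subproof (proj₂ x) q)
subproof-++ σ              []                q = refl
subproof-++ (ax b P ts)    (k ∷ p)           q = refl
subproof-++ (orR ρ)        (0 ∷ p)           q = subproof-++ ρ p q
subproof-++ (orR ρ)        (suc k ∷ p)       q = refl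
subproof-++ (andR ρ ρ₁)    (0 ∷ p)           q = subproof-++ ρ p q
subproof-++ (andR ρ ρ₁)    (1 ∷ p)           q = subproof-++ ρ₁ p q
subproof-++ (andR ρ ρ₁)    (suc (suc k) ∷ p) q = refl
subproof-++ (allR A α x ρ) (0 ∷ p)           q = subproof-++ ρ p q
subproof-++ (allR A α x ρ) (suc k ∷ p)       q = refl
subproof-++ (exR A r ρ)    (0 ∷ p)           q = subproof-++ ρ p q
subproof-++ (exR A r ρ)    (suc k ∷ p)       q = refl
subproof-++ (cut A ρ ρ₁)   (0 ∷ p)           q = subproof-++ ρ p q
subproof-++ (cut A ρ ρ₁)   (1 ∷ p)           q = subproof-++ ρ₁ p q
subproof-++ (cut A ρ ρ₁)   (suc (suc k) ∷ p) q = refl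
subproof-++ (weak A ρ)     (0 ∷ p)           q = subproof-++ ρ p q
subproof-++ (weak A ρ)     (suc k ∷ p)       q = refl
subproof-++ (contr ρ)      (0 ∷ p)           q = subproof-++ ρ p q
subproof-++ (contr ρ)      (suc k ∷ p)       q = refl
subproof-++ (perm Γ ρ)     (0 ∷ p)           q = subproof-++ ρ p q
subproof-++ (perm Γ ρ)     (suc k ∷ p)       q = refl

take-all : ∀ j (l : List Tm) → length (take j l) ≡ length l → take j l ≡ l × drop j l ≡ []
take-all zero    []      e = refl , refl
take-all (suc j) []      e = refl , refl
take-all (suc j) (x ∷ l) e with take≡ , drop≡ ← take-all j l (suc-injective e) = cong (x ∷_) take≡ , drop≡

module _ {Γ₀ : Seq} (π : Proof Γ₀) (c : ℕ) where

  infix 4 _⟶_ _⟶*_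

  _⟶_ : Tm → Tm → Set
  _⟶_ = Step c π

  _⟶*_ : Tm → Tm → Set
  _⟶*_ = Derives c π

  -- Stability under substitution: if  t ⟶ t'  then  t[j := u] ⟶ t'[j := u] .
  -- This is what lets a derivation inside the body of a λ be replayed after β-reduction.

  private
    rule-cast : ∀ {Δ} {ρ : Proof Δ} {p i a a' r r'} →
      RootRule c ρ p i a r → a ≡ a' → r ≡ r' → RootRule c ρ p i a' r'
    rule-cast rule refl refl = rule

  module _ (j : ℕ) (u : Tm) where
    private
      f : Tm → Tm
      f = substAt j u

      len : ∀ {n} ys → length ys ≡ n → length (map f ys) ≡ n
      len ys l = trans (length-map f ys) l

      f-apps : ∀ h xs → f (apps h xs) ≡ apps (f h) (map f xs)
      f-apps = substAt-apps j u

      f-++ : ∀ z xs ys → f z ∷ map f (xs ++ ys) ≡ f z ∷ map f xs ++ map f ys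
      f-++ z xs ys = cong (f z ∷_) (map-++ f xs ys)

      f-dotr : ∀ A z r h ys → f (apps h (dotr (∃' A) z r ∷ ys))
                             ≡ apps (f h) (dotr (∃' A) (f z) r ∷ map f ys)
      f-dotr A z r h ys = trans (f-apps h (dotr (∃' A) z r ∷ ys))
                                (cong (λ w → apps (f h) (w ∷ map f ys)) (substAt-dotr j u (∃' A) z r))

    rule-substAt : ∀ {Δ} {ρ : Proof Δ} {p i args r} → RootRule c ρ p i args r →
                   RootRule c ρ p i (map f args) (f r)
    rule-substAt r-ax0 = r-ax0
    rule-substAt r-ax1 = r-ax1
    rule-substAt (r-or0 {ys = ys} l) = r-or0 (len ys l)
    rule-substAt (r-orS {ys = ys} l q) =
      rule-cast (r-orS (len ys l) q) refl (sym (f-apps _ (unit ∷ unit ∷ ys)))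
    rule-substAt (r-and0 {z = z} {xs} {ys} lx ly) =
      rule-cast (r-and0 {xs = map f xs} (len xs lx) (len ys ly)) (sym (f-++ z xs ys)) refl
    rule-substAt (r-andL {z = z} {xs} {ys} lx ly q) =
      rule-cast (r-andL {xs = map f xs} (len xs lx) (len ys ly) q) (sym (f-++ z xs ys)) (sym (f-apps _ (unit ∷ xs)))
    rule-substAt (r-andR {z = z} {xs} {ys} lx ly q) =
      rule-cast (r-andR {xs = map f xs} (len xs lx) (len ys ly) q) (sym (f-++ z xs ys)) (sym (f-apps _ (unit ∷ ys)))
    rule-substAt (r-all {z₁ = z₁} {ys} l q) =
      rule-cast (r-all (len ys l) q) refl (cong (λ w → esub w _ _) (sym (f-apps _ (z₁ ∷ ys))))
    rule-substAt (r-ex0 {A = A} {r} {z = z} {ys} l) =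
      rule-cast (r-ex0 (len ys l)) refl (cong (pair (trm r)) (sym (f-dotr A z r _ ys)))
    rule-substAt (r-exS {A = A} {r} {z = z} {ys} l q) =
      rule-cast (r-exS (len ys l) q) refl (sym (f-dotr A z r _ ys))
    rule-substAt (r-cutL {A = A} {p = p} {xs} {ys} lx ly q) =
      rule-cast (r-cutL {xs = map f xs} (len xs lx) (len ys ly) q) (sym (map-++ f xs ys))
        (sym (trans (f-apps _ (compose (dual A) (child p 1) (child p 0) ys xs ∷ xs))
                    (cong (λ w → apps _ (w ∷ map f xs)) (substAt-compose (dual A) _ _ j u ys xs))))
    rule-substAt (r-cutR {A = A} {p = p} {xs} {ys} lx ly q) =
      rule-cast (r-cutR {xs = map f xs} (len xs lx) (len ys ly) q) (sym (map-++ f xs ys))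
        (sym (trans (f-apps _ (compose A (child p 0) (child p 1) xs ys ∷ ys))
                    (cong (λ w → apps _ (w ∷ map f ys)) (substAt-compose A _ _ j u xs ys))))
    rule-substAt (r-w0 {A = A} {ys = ys} l) =
      rule-cast (r-w0 (len ys l)) refl
        (sym (trans (substAt-tuple j u (replicate (nExists A) (trm (fn c []))))
                    (cong tuple (substAt-constants j u (nExists A) (fn c [])))))
    rule-substAt (r-wS {ys = ys} l q) = rule-cast (r-wS (len ys l) q) refl (sym (f-apps _ ys))
    rule-substAt (r-c00 {z = z} {ys} l) = rule-cast (r-c00 (len ys l)) refl (sym (f-apps _ (z ∷ z ∷ ys)))
    rule-substAt (r-c01 {z = z} {ys} l) = rule-cast (r-c01 (len ys l)) refl (sym (f-apps _ (z ∷ z ∷ ys)))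
    rule-substAt (r-cS {z = z} {ys} l q) = rule-cast (r-cS (len ys l) q) refl (sym (f-apps _ (z ∷ z ∷ ys)))
    rule-substAt (r-perm {Γ = Γ} {args = args} l q) =
      rule-cast (r-perm {args = map f args} (len args l) (subst (_ <_) (sym (length-map f args)) q)) refl
        (sym (trans (f-apps _ (swapAt (length Γ) args)) (cong (apps _) (map-swapAt f (length Γ) args))))

  step-substAt : ∀ j u {t t'} → t ⟶ t' → substAt j u t ⟶ substAt j u t'
  step-substAt j u (prod (p , Δ , ρ , i , args , sp , rule , refl)) =
    prod (p , Δ , ρ , i , map (substAt j u) args , sp , rule-substAt j u rule , substAt-apps j u (nt (p , i)) args)
  step-substAt j u (beta {t} {v}) = subst (app (lam (substAt (suc j) u t)) (substAt j u v) ⟶_) (sym (substAt-substAt 0 j u v t)) beta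
  step-substAt j u (lamS s)  = lamS (step-substAt (suc j) u s)
  step-substAt j u (appL s)  = appL (step-substAt j u s)
  step-substAt j u (appR s)  = appR (step-substAt j u s)
  step-substAt j u (pairL s) = pairL (step-substAt j u s)
  step-substAt j u (pairR s) = pairR (step-substAt j u s)
  step-substAt j u (esubL s) = esubL (step-substAt j u s)
  step-substAt j u (esubR s) = esubR (step-substAt j u s)

  derives-msubst : ∀ us {t t'} → t ⟶* t' → msubst us t ⟶* msubst us t'
  derives-msubst []       s = s
  derives-msubst (u ∷ us) s = derives-msubst us (gmap (substAt (length us) u) (step-substAt (length us) u) s)

  production-head : ∀ {l r} → Prod c π l r → Σ NT λ a → proj₁ (spine l) ≡ nt a
  production-head (p , Δ , ρ , i , args , sp , rule , refl) = (p , i) , head-apps (nt (p , i)) args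

  RootStep : Tm → Tm → Set
  RootStep s r = Prod c π s r ⊎ (Σ Tm λ b → Σ Tm λ v → s ≡ app (lam b) v × r ≡ substAt 0 v b)

  data ArgStep : List Tm → List Tm → Set where
    here  : ∀ {x x' xs} → x ⟶ x' → ArgStep (x ∷ xs) (x' ∷ xs)
    there : ∀ {x xs xs'} → ArgStep xs xs' → ArgStep (x ∷ xs) (x ∷ xs')

  step-apps-inversion : ∀ h xs {t'} → apps h xs ⟶ t' →
    (Σ Tm λ h' → h ⟶ h' × t' ≡ apps h' xs) ⊎
    (Σ (List Tm) λ xs' → ArgStep xs xs' × t' ≡ apps h xs') ⊎
    (Σ ℕ λ j → Σ Tm λ r → RootStep (apps h (take (suc j) xs)) r × t' ≡ apps r (drop (suc j) xs))
  step-apps-inversion h [] s = inj₁ (_ , s , refl)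
  step-apps-inversion h (x ∷ xs) s with step-apps-inversion (app h x) xs s
  ... | inj₁ (_ , prod pr , refl) = inj₂ (inj₂ (0 , _ , inj₁ pr , refl))
  ... | inj₁ (_ , beta , refl)    = inj₂ (inj₂ (0 , _ , inj₂ (_ , _ , refl , refl) , refl))
  ... | inj₁ (_ , appL s' , refl) = inj₁ (_ , s' , refl)
  ... | inj₁ (_ , appR s' , refl) = inj₂ (inj₁ (_ , here s' , refl))
  ... | inj₂ (inj₁ (xs' , s₁ , refl))         = inj₂ (inj₁ (x ∷ xs' , there s₁ , refl))
  ... | inj₂ (inj₂ (j , r , root , refl))     = inj₂ (inj₂ (suc j , r , root , refl))

  _⟶*ᵖ_ : List Tm → List Tm → Set
  _⟶*ᵖ_ = Pointwise _⟶*_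

  ⟶*ᵖ-refl : ∀ xs → xs ⟶*ᵖ xs
  ⟶*ᵖ-refl xs = Pointwise.refl ε

  ⟶*ᵖ-trans : ∀ {xs ys zs} → xs ⟶*ᵖ ys → ys ⟶*ᵖ zs → xs ⟶*ᵖ zs
  ⟶*ᵖ-trans = Pointwise.transitive _◅◅_

  argStep⇒⟶*ᵖ : ∀ {xs xs'} → ArgStep xs xs' → xs ⟶*ᵖ xs'
  argStep⇒⟶*ᵖ (here {xs = xs} s) = (s ◅ ε) ∷ ⟶*ᵖ-refl xs
  argStep⇒⟶*ᵖ (there s)          = ε ∷ argStep⇒⟶*ᵖ s

  apps-head-derives : ∀ {h h'} xs → h ⟶* h' → apps h xs ⟶* apps h' xs
  apps-head-derives xs = gmap (λ h → apps h xs) (apps-head-step xs)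
    where
      apps-head-step : ∀ {h h'} xs → h ⟶ h' → apps h xs ⟶ apps h' xs
      apps-head-step []       s = s
      apps-head-step (x ∷ xs) s = apps-head-step xs (appL s)

  pairL* : ∀ {t t' u} → t ⟶* t' → pair t u ⟶* pair t' u
  pairL* {u = u} = gmap (λ t → pair t u) pairL

  pairR* : ∀ {t u u'} → u ⟶* u' → pair t u ⟶* pair t u'
  pairR* {t} = gmap (pair t) pairR

  -- Inversion: constructors other than application and non-terminals are never
  -- rewritten at the root, so derivations from them proceed componentwise.

  pair-derives : ∀ {t u T} → pair t u ⟶* T →
    Σ Tm λ t' → Σ Tm λ u' → T ≡ pair t' u' × t ⟶* t' × u ⟶* u'
  pair-derives ε = _ , _ , refl , ε , ε
  pair-derives (prod pr ◅ _) with () ← proj₂ (production-head pr)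
  pair-derives (pairL s ◅ r) with t' , u' , refl , a , b ← pair-derives r = t' , u' , refl , s ◅ a , b
  pair-derives (pairR s ◅ r) with t' , u' , refl , a , b ← pair-derives r = t' , u' , refl , a , s ◅ b

  esub-derives : ∀ {t α u T} → esub t α u ⟶* T →
    Σ Tm λ t' → Σ Tm λ u' → T ≡ esub t' α u' × t ⟶* t' × u ⟶* u'
  esub-derives ε = _ , _ , refl , ε , ε
  esub-derives (prod pr ◅ _) with () ← proj₂ (production-head pr)
  esub-derives (esubL s ◅ r) with t' , u' , refl , a , b ← esub-derives r = t' , u' , refl , s ◅ a , b
  esub-derives (esubR s ◅ r) with t' , u' , refl , a , b ← esub-derives r = t' , u' , refl , a , s ◅ b

  unit-derives : ∀ {T} → unit ⟶* T → T ≡ unit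
  unit-derives ε = refl
  unit-derives (prod pr ◅ _) with () ← proj₂ (production-head pr)

  trm-derives : ∀ {x T} → trm x ⟶* T → T ≡ trm x
  trm-derives ε = refl
  trm-derives (prod pr ◅ _) with () ← proj₂ (production-head pr)

  lam-derives : ∀ {b T} → lam b ⟶* T → Σ Tm λ b' → T ≡ lam b' × b ⟶* b'
  lam-derives ε = _ , refl , ε
  lam-derives (prod pr ◅ _) with () ← proj₂ (production-head pr)
  lam-derives (lamS s ◅ r) with b' , refl , a ← lam-derives r = b' , refl , s ◅ a

  lams-derives : ∀ k {b T} → lams k b ⟶* T → Σ Tm λ b' → T ≡ lams k b' × b ⟶* b'
  lams-derives zero    s = _ , refl , s
  lams-derives (suc k) s with b₁ , refl , s₁ ← lam-derives s
                          with b' , refl , s' ← lams-derives k s₁ = b' , refl , s'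

  -- Finite over-approximation of derivable terms

  Sets : Set
  Sets = List (List Term)

  AbsFun : Set
  AbsFun = Sets → Sets

  setAt : ℕ → Sets → List Term
  setAt _       []      = []
  setAt zero    (S ∷ _)  = S
  setAt (suc k) (_ ∷ Ss) = setAt k Ss

  mutual
    component : ℕ → Tm → Maybe Term
    component k (pair t u)   = componentOfPair k t u
    component k (esub t α u) = component k t >>= λ s → evalO u >>= λ v → just (substFV α v s)
    component k _            = nothing

    componentOfPair : ℕ → Tm → Tm → Maybe Term
    componentOfPair zero    t u = evalO t
    componentOfPair (suc k) t u = component k u

  record Approx (t : Tm) (S : Sets) : Set where
    constructor mkApprox
    field approx : ∀ T → t ⟶* T → ∀ k r → component k T ≡ just r → r ∈ setAt k S
  open Approx public

  record ApproxTerm (t : Tm) (S : List Term) : Set where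
    constructor mkApproxTerm
    field approxTerm : ∀ T → t ⟶* T → ∀ r → evalO T ≡ just r → r ∈ S
  open ApproxTerm public

  data ApproxTerms : List Tm → Sets → Set where
    []  : ApproxTerms [] []
    _∷_ : ∀ {u us S Ss} → ApproxTerm u S → ApproxTerms us Ss → ApproxTerms (u ∷ us) (S ∷ Ss)

  record ApproxFun (k : ℕ) (t : Tm) (v : AbsFun) : Set where
    constructor mkApproxFun
    field approxFun : ∀ us Ss → length us ≡ k → ApproxTerms us Ss → Approx (apps t us) (v Ss)
  open ApproxFun public

  Approx-⟶* : ∀ {t t' S} → Approx t S → t ⟶* t' → Approx t' S
  Approx-⟶* h s = mkApprox λ T s' → approx h T (s ◅◅ s')

  ApproxTerm-⟶* : ∀ {t t' S} → ApproxTerm t S → t ⟶* t' → ApproxTerm t' S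
  ApproxTerm-⟶* h s = mkApproxTerm λ T s' → approxTerm h T (s ◅◅ s')

  ApproxFun-⟶* : ∀ {k t t' v} → ApproxFun k t v → t ⟶* t' → ApproxFun k t' v
  ApproxFun-⟶* h s = mkApproxFun λ us Ss l hs → Approx-⟶* (approxFun h us Ss l hs) (apps-head-derives us s)

  ApproxTerms-⟶*ᵖ : ∀ {us us' Ss} → ApproxTerms us Ss → us ⟶*ᵖ us' → ApproxTerms us' Ss
  ApproxTerms-⟶*ᵖ []       []       = []
  ApproxTerms-⟶*ᵖ (h ∷ hs) (s ∷ ss) = ApproxTerm-⟶* h s ∷ ApproxTerms-⟶*ᵖ hs ss

  ApproxFun₀ : ∀ {t v} → Approx t (v []) → ApproxFun 0 t v
  ApproxFun₀ h = mkApproxFun λ { [] [] refl [] → h }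

  ApproxFun₀⁻ : ∀ {t v} → ApproxFun 0 t v → Approx t (v [])
  ApproxFun₀⁻ h = approxFun h [] [] refl []

  Approx-mono : ∀ {t S S'} → (∀ k {r} → r ∈ setAt k S → r ∈ setAt k S') → Approx t S → Approx t S'
  Approx-mono S⊆S' h = mkApprox λ T s k r e → S⊆S' k (approx h T s k r e)

  Approx-unit : ∀ {S} → Approx unit S
  Approx-unit {S} = mkApprox unit-has-no-component
    where
      unit-has-no-component : ∀ T → unit ⟶* T → ∀ k r → component k T ≡ just r → r ∈ setAt k S
      unit-has-no-component T s k r e with refl ← unit-derives s with () ← e

  ApproxTerm-trm : ∀ x → ApproxTerm (trm x) (x ∷ [])
  ApproxTerm-trm x = mkApproxTerm trm-evaluates
    where
      trm-evaluates : ∀ T → trm x ⟶* T → ∀ r → evalO T ≡ just r → r ∈ x ∷ []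
      trm-evaluates T s r e with refl ← trm-derives s with refl ← e = here refl

  Approx-pair : ∀ {t u S Ss} → ApproxTerm t S → Approx u Ss → Approx (pair t u) (S ∷ Ss)
  Approx-pair {t} {u} {S} {Ss} ht hu = mkApprox components
    where
      components : ∀ T → pair t u ⟶* T → ∀ k r → component k T ≡ just r → r ∈ setAt k (S ∷ Ss)
      components T s k r e with pair-derives s
      components T s zero    r e | t' , u' , refl , st , su = approxTerm ht t' st r e
      components T s (suc k) r e | t' , u' , refl , st , su = approx hu u' su k r e

  Approx-pair⁻ˡ : ∀ {t u S} → Approx (pair t u) S → ApproxTerm t (setAt 0 S)
  Approx-pair⁻ˡ h = mkApproxTerm λ T s r e → approx h (pair T _) (pairL* s) 0 r e

  Approx-pair⁻ʳ : ∀ {t u S} → Approx (pair t u) S → Approx u (drop 1 S)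
  Approx-pair⁻ʳ {S = S} h =
    mkApprox λ T s k r e → subst (r ∈_) (setAt-suc k S) (approx h (pair _ T) (pairR* s) (suc k) r e)
    where
      setAt-suc : ∀ k S → setAt (suc k) S ≡ setAt k (drop 1 S)
      setAt-suc k []      = refl
      setAt-suc k (_ ∷ S) = refl

  Approx-tuple : ∀ {us Ss} → ApproxTerms us Ss → Approx (tuple us) Ss
  Approx-tuple []       = Approx-unit
  Approx-tuple (h ∷ hs) = Approx-pair h (Approx-tuple hs)

  substImage : ℕ → List Term → Sets → Sets
  substImage α V = map (cartesianProductWith (λ v s → substFV α v s) V)

  setAt-substImage : ∀ α V k S →
    setAt k (substImage α V S) ≡ cartesianProductWith (λ v s → substFV α v s) V (setAt k S)
  setAt-substImage α V k       []      = sym (cartesianProductWith-zeroʳ _ V)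
  setAt-substImage α V zero    (_ ∷ S) = refl
  setAt-substImage α V (suc k) (_ ∷ S) = setAt-substImage α V k S

  Approx-esub : ∀ {t u α S V} → Approx t S → ApproxTerm u V → Approx (esub t α u) (substImage α V S)
  Approx-esub {t} {u} {α} {S} {V} ht hu = mkApprox components
    where
      components : ∀ T → esub t α u ⟶* T → ∀ k r → component k T ≡ just r → r ∈ setAt k (substImage α V S)
      components T s k r e with t' , u' , refl , st , su ← esub-derives s
                           with component k t' in et | evalO u' in eu
      ...   | just s₁ | just v with refl ← e =
        subst (substFV α v s₁ ∈_) (sym (setAt-substImage α V k S))
          (∈-cartesianProductWith⁺ (λ v s → substFV α v s) (approxTerm hu u' su v eu) (approx ht t' st k s₁ et))

  -- componentwise union, the bound of a non-deterministic choice

  _∪_ : Sets → Sets → Sets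
  []      ∪ T       = T
  (a ∷ S) ∪ []      = a ∷ S
  (a ∷ S) ∪ (b ∷ T) = (a ++ b) ∷ (S ∪ T)

  setAt-∪ : ∀ k S T → setAt k (S ∪ T) ≡ setAt k S ++ setAt k T
  setAt-∪ k       []      T       = refl
  setAt-∪ zero    (a ∷ S) []      = sym (++-identityʳ a)
  setAt-∪ (suc k) (a ∷ S) []      = sym (++-identityʳ (setAt k S))
  setAt-∪ zero    (a ∷ S) (b ∷ T) = refl
  setAt-∪ (suc k) (a ∷ S) (b ∷ T) = setAt-∪ k S T

  Approx-∪ˡ : ∀ {t S} T → Approx t S → Approx t (S ∪ T)
  Approx-∪ˡ {S = S} T = Approx-mono λ k m → subst (_ ∈_) (sym (setAt-∪ k S T)) (∈-++⁺ˡ m)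

  Approx-∪ʳ : ∀ {t T} S → Approx t T → Approx t (S ∪ T)
  Approx-∪ʳ {T = T} S = Approx-mono λ k m → subst (_ ∈_) (sym (setAt-∪ k S T)) (∈-++⁺ʳ (setAt k S) m)

  component-apps : ∀ k h x xs → component k (apps h (x ∷ xs)) ≡ nothing
  component-apps k h x []       = refl
  component-apps k h x (y ∷ xs) = component-apps k (app h x) y xs

  component-nt-apps : ∀ k a xs → component k (apps (nt a) xs) ≡ nothing
  component-nt-apps k a []       = refl
  component-nt-apps k a (x ∷ xs) = component-apps k (nt a) x xs

  unit-apps-stuck : ∀ {u us T} → apps unit (u ∷ us) ⟶* T →
    Σ Tm λ u' → Σ (List Tm) λ us' → T ≡ apps unit (u' ∷ us')
  unit-apps-stuck {u} {us} ε = u , us , refl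
  unit-apps-stuck {u} {us} (s ◅ r) with step-apps-inversion unit (u ∷ us) s
  ... | inj₁ (_ , prod pr , refl) with () ← proj₂ (production-head pr)
  ... | inj₂ (inj₁ (_ , here {x' = u'} _ , refl))   = unit-apps-stuck {u'} {us} r
  ... | inj₂ (inj₁ (_ , there {xs' = us'} _ , refl)) = unit-apps-stuck {u} {us'} r
  ... | inj₂ (inj₂ (j , _ , inj₁ pr , refl))
        with () ← trans (sym (head-apps unit (take (suc j) (u ∷ us)))) (proj₂ (production-head pr))
  ... | inj₂ (inj₂ (j , _ , inj₂ (_ , _ , e , _) , refl))
        with () ← trans (sym (head-apps unit (take (suc j) (u ∷ us)))) (cong (proj₁ ∘ spine) e)

  ApproxFun-unit : ∀ a → ApproxFun a unit (λ _ → [])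
  ApproxFun-unit zero    = ApproxFun₀ Approx-unit
  ApproxFun-unit (suc a) = mkApproxFun λ { (u ∷ us) Ss _ _ → mkApprox (no-components u us) }
    where
      no-components : ∀ u us T → apps unit (u ∷ us) ⟶* T → ∀ k r → component k T ≡ just r → r ∈ setAt k []
      no-components u us T s k r e with u' , us' , refl ← unit-apps-stuck {u} {us} s
        with () ← trans (sym (component-apps k unit u' us')) e

  ContractaBounded : Tm → Tm → List Tm → Sets → Set
  ContractaBounded b u us S =
    ∀ {b' u' us'} → b ⟶* b' → u ⟶* u' → us ⟶*ᵖ us' → Approx (apps (substAt 0 u' b') us') S

  private
    head-expansion-components : ∀ {b u us S T} → ContractaBounded b u us S →
      apps (app (lam b) u) us ⟶* T → ∀ k r → component k T ≡ just r → r ∈ setAt k S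
    head-expansion-components {b} {u} {us} H ε k r e with () ← trans (sym (component-apps k (lam b) u us)) e
    head-expansion-components {b} {u} {us} H (s ◅ rest) k r e with step-apps-inversion (lam b) (u ∷ us) s
    ... | inj₁ (_ , lamS s' , refl) =
      head-expansion-components (λ sb su sus → H (s' ◅ sb) su sus) rest k r e
    ... | inj₁ (_ , prod pr , refl) with () ← proj₂ (production-head pr)
    ... | inj₂ (inj₁ (_ , here s' , refl)) =
      head-expansion-components (λ sb su sus → H sb (s' ◅ su) sus) rest k r e
    ... | inj₂ (inj₁ (_ , there s' , refl)) =
      head-expansion-components (λ sb su sus → H sb su (⟶*ᵖ-trans (argStep⇒⟶*ᵖ s') sus)) rest k r e
    ... | inj₂ (inj₂ (zero , _ , inj₁ pr , refl)) with () ← proj₂ (production-head pr)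
    ... | inj₂ (inj₂ (zero , _ , inj₂ (_ , _ , refl , refl) , refl)) = approx (H ε ε (⟶*ᵖ-refl us)) _ rest k r e
    ... | inj₂ (inj₂ (suc j , _ , root , refl)) with us | root
    ...   | [] | inj₁ pr with () ← proj₂ (production-head pr)
    ...   | [] | inj₂ (_ , _ , refl , refl) = approx (H ε ε []) _ rest k r e
    ...   | v ∷ vs | inj₁ pr
            with () ← trans (sym (head-apps (lam b) (u ∷ v ∷ take j vs))) (proj₂ (production-head pr))
    ...   | v ∷ vs | inj₂ (_ , _ , e' , _)
            with () ← trans (sym (cong proj₂ (spine-apps (lam b) (u ∷ v ∷ take j vs)))) (cong (proj₂ ∘ spine) e')

  head-expansion : ∀ {b u us S} → ContractaBounded b u us S → Approx (apps (app (lam b) u) us) S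
  head-expansion H = mkApprox λ T s → head-expansion-components H s

  derives-from-nt : ∀ {a xs T} → apps (nt a) xs ⟶* T →
    (Σ (List Tm) λ xs' → xs ⟶*ᵖ xs' × T ≡ apps (nt a) xs') ⊎
    (Σ (List Tm) λ xs' → Σ ℕ λ j → Σ Tm λ r →
       xs ⟶*ᵖ xs' × Prod c π (apps (nt a) (take j xs')) r × apps r (drop j xs') ⟶* T)
  derives-from-nt {a} {xs} ε = inj₁ (xs , ⟶*ᵖ-refl xs , refl)
  derives-from-nt {a} {xs} (s ◅ rest) with step-apps-inversion (nt a) xs s
  ... | inj₁ (_ , prod pr , refl) = inj₂ (xs , 0 , _ , ⟶*ᵖ-refl xs , pr , rest)
  ... | inj₂ (inj₂ (j , r , inj₁ pr , refl)) = inj₂ (xs , suc j , r , ⟶*ᵖ-refl xs , pr , rest)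
  ... | inj₂ (inj₂ (j , r , inj₂ (_ , _ , e , _) , refl))
        with () ← trans (sym (head-apps (nt a) (take (suc j) xs))) (cong (proj₁ ∘ spine) e)
  ... | inj₂ (inj₁ (xs₁ , s₁ , refl)) with derives-from-nt {a} {xs₁} rest
  ...   | inj₁ (xs' , ss , e) = inj₁ (xs' , ⟶*ᵖ-trans (argStep⇒⟶*ᵖ s₁) ss , e)
  ...   | inj₂ (xs' , j , r , ss , pr , st) = inj₂ (xs' , j , r , ⟶*ᵖ-trans (argStep⇒⟶*ᵖ s₁) ss , pr , st)

  BodyBound : ℕ → Tm → AbsFun → Set
  BodyBound k b F = ∀ us Ss → length us ≡ k → ApproxTerms us Ss → Approx (msubst us b) (F Ss)

  BodyBound-⟶* : ∀ {k b b' F} → BodyBound k b F → b ⟶* b' → BodyBound k b' F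
  BodyBound-⟶* g s us Ss l hs = Approx-⟶* (g us Ss l hs) (derives-msubst us s)

  ApproxFun-lams : ∀ k b F → BodyBound k b F → ApproxFun k (lams k b) F
  ApproxFun-lams zero    b F g = mkApproxFun λ { [] [] refl [] → g [] [] refl [] }
  ApproxFun-lams (suc k) b F g = mkApproxFun λ { (u ∷ us) (S ∷ Ss) l (hu ∷ hus) →
    head-expansion (contracta u us S Ss (suc-injective l) hu hus) }
    where
      contracta : ∀ u us S Ss → length us ≡ k → ApproxTerm u S → ApproxTerms us Ss →
                  ContractaBounded (lams k b) u us (F (S ∷ Ss))
      contracta u us S Ss l hu hus {us' = us'} sb su sus with b' , refl , sb' ← lams-derives k sb =
        subst (λ z → Approx (apps z us') (F (S ∷ Ss))) (sym (substAt-lams k 0 _ b'))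
          (approxFun (ApproxFun-lams k (substAt (k + 0) _ b') (λ Rs → F (S ∷ Rs)) instances) us' Ss
            (trans (sym (Pointwise-length sus)) l) (ApproxTerms-⟶*ᵖ hus sus))
        where
          instances : BodyBound k (substAt (k + 0) _ b') (λ Rs → F (S ∷ Rs))
          instances vs Rs lv hvs =
            subst (λ z → Approx (msubst vs (substAt z _ b')) (F (S ∷ Rs))) (trans lv (sym (+-identityʳ k)))
              (BodyBound-⟶* g sb' (_ ∷ vs) (S ∷ Rs) (cong suc lv) (ApproxTerm-⟶* hu su ∷ hvs))

  -- The abstract interpretation of the grammar
  --
  -- bound ρ env  mirrors the production rules of the non-terminals σ^i_ρ, with every
  -- argument replaced by an abstract value (env) and every non-deterministic choice
  -- by a union.  It is defined by recursion on ρ, which is possible because all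
  -- arguments have type o^m or o → ⋯ → o → o^n (the cut formulas are Π₂/Σ₂), so
  -- abstract values are maps between finite sets of first-order terms.

  absDot : Formula → AbsFun → Term → AbsFun
  absDot F v r = if isΣ1b F then v else (λ Ss → v ((r ∷ []) ∷ Ss))

  absCompose : Formula → (List AbsFun → Sets) → (List AbsFun → Sets) → List AbsFun → List AbsFun → AbsFun
  absCompose F s₀ s₁ ex ey with cutShape F
  ... | cUnit      = const []
  ... | cLam k     = λ Ss → s₀ (const Ss ∷ ex)
  ... | cApp k     = const (s₀ ((λ Ss → s₁ (const Ss ∷ ey)) ∷ ex))
  ... | cAppUnit k = const (s₀ (const [] ∷ ex))

  swapAbs : ℕ → List AbsFun → List AbsFun
  swapAbs zero    (a ∷ b ∷ r) = b ∷ a ∷ r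
  swapAbs (suc k) (a ∷ r)     = a ∷ swapAbs k r
  swapAbs _       l           = l

  bound : ∀ {Δ} → Proof Δ → List AbsFun → Sets
  bound (ax b P ts)    (v₀ ∷ v₁ ∷ _) = v₀ [] ∪ v₁ []
  bound (orR ρ)        (_ ∷ ys)      = bound ρ (const [] ∷ const [] ∷ ys)
  bound (andR {Γ = Γ} ρ₀ ρ₁) (_ ∷ e) =
    bound ρ₀ (const [] ∷ take (length Γ) e) ∪ bound ρ₁ (const [] ∷ drop (length Γ) e)
  bound (allR A α _ ρ) (z ∷ ys)      = substImage α (setAt 0 (z [])) (bound ρ (const (drop 1 (z [])) ∷ ys))
  bound (exR A r ρ)    (z ∷ ys)      =
    ((r ∷ []) ∷ bound ρ (absDot (∃' A) z r ∷ ys)) ∪ bound ρ (absDot (∃' A) z r ∷ ys)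
  bound (cut {Γ = Γ} A ρ₀ ρ₁) e      =
    bound ρ₀ (absCompose (dual A) (bound ρ₁) (bound ρ₀) ey ex ∷ ex) ∪
    bound ρ₁ (absCompose A (bound ρ₀) (bound ρ₁) ex ey ∷ ey)
    where
      ex = take (length Γ) e
      ey = drop (length Γ) e
  bound (weak A ρ)     (_ ∷ ys)      = replicate (nExists A) (fn c [] ∷ []) ∪ bound ρ ys
  bound (contr ρ)      (z ∷ ys)      = bound ρ (z ∷ z ∷ ys)
  bound (perm Γ ρ)     e             = bound ρ (swapAbs (length Γ) e)
  bound _              _             = []

  data ApproxArgs : Seq → List Tm → List AbsFun → Set where
    []  : ApproxArgs [] [] []
    _∷_ : ∀ {A Δ t ts v vs} → ApproxFun (oArity A) t v → ApproxArgs Δ ts vs → ApproxArgs (A ∷ Δ) (t ∷ ts) (v ∷ vs)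

  ApproxArgs-length : ∀ {Δ args env} → ApproxArgs Δ args env → length args ≡ length Δ
  ApproxArgs-length []       = refl
  ApproxArgs-length (_ ∷ hs) = cong suc (ApproxArgs-length hs)

  ApproxArgs-⟶*ᵖ : ∀ {Δ args args' env} → ApproxArgs Δ args env → args ⟶*ᵖ args' → ApproxArgs Δ args' env
  ApproxArgs-⟶*ᵖ []       []       = []
  ApproxArgs-⟶*ᵖ (h ∷ hs) (s ∷ ss) = ApproxFun-⟶* h s ∷ ApproxArgs-⟶*ᵖ hs ss

  ApproxArgs-split : ∀ Γ {Δ xs ys env} → ApproxArgs (Γ ++ Δ) (xs ++ ys) env → length xs ≡ length Γ →
    ApproxArgs Γ xs (take (length Γ) env) × ApproxArgs Δ ys (drop (length Γ) env)
  ApproxArgs-split []      {xs = []}     hs       refl = [] , hs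
  ApproxArgs-split (A ∷ Γ) {xs = x ∷ xs} (h ∷ hs) l
    with hΓ , hΔ ← ApproxArgs-split Γ {xs = xs} hs (suc-injective l) = (h ∷ hΓ) , hΔ

  ApproxArgs-swap : ∀ Γ {A B Δ args env} → ApproxArgs (Γ ++ A ∷ B ∷ Δ) args env →
    ApproxArgs (Γ ++ B ∷ A ∷ Δ) (swapAt (length Γ) args) (swapAbs (length Γ) env)
  ApproxArgs-swap []      (h₁ ∷ h₂ ∷ hs) = h₂ ∷ h₁ ∷ hs
  ApproxArgs-swap (C ∷ Γ) (h ∷ hs)       = h ∷ ApproxArgs-swap Γ hs

  All-swap : ∀ {P : Formula → Set} Γ {A B Δ} → All P (Γ ++ A ∷ B ∷ Δ) → All P (Γ ++ B ∷ A ∷ Δ)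
  All-swap []      (a ∷ b ∷ r) = b ∷ a ∷ r
  All-swap (C ∷ Γ) (h ∷ r)     = h ∷ All-swap Γ r

  premise-at : ∀ {p Δ} {ρ : Proof Δ} k → subproof π p ≡ just (Δ , ρ) →
    subproof π (child p k) ≡ subproof ρ (k ∷ [])
  premise-at {p} k sp rewrite subproof-++ π p (k ∷ []) | sp = refl

  production-at : ∀ {Δ} {ρ : Proof Δ} {p i args rhs} → subproof π p ≡ just (Δ , ρ) →
    Prod c π (apps (nt (p , i)) args) rhs → RootRule c ρ p i args rhs
  production-at {p = p} {i} {args} sp (p' , Δ' , ρ' , i' , args' , sp' , rule , e)
    with refl ← trans (sym (spine-apps (nt (p , i)) args)) (trans (cong spine e) (spine-apps (nt (p' , i')) args'))
    with refl ← trans (sym sp) sp' = rule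

  private
    length-split : ∀ (Γ Δ : Seq) (xs ys : List Tm) → length xs ≡ length Γ → length ys ≡ length Δ →
      length (xs ++ ys) ≡ length (Γ ++ Δ)
    length-split Γ Δ xs ys lx ly = trans (length-++ xs) (trans (cong₂ _+_ lx ly) (sym (length-++ Γ)))

  rule-arity : ∀ {Δ} {ρ : Proof Δ} {p i args rhs} → RootRule c ρ p i args rhs → length args ≡ length Δ
  rule-arity r-ax0 = refl
  rule-arity r-ax1 = refl
  rule-arity (r-or0 l)    = cong suc l
  rule-arity (r-orS l _)  = cong suc l
  rule-arity (r-and0 {Γ = Γ} {Δ} {xs = xs} {ys} lx ly)   = cong suc (length-split Γ Δ xs ys lx ly)
  rule-arity (r-andL {Γ = Γ} {Δ} {xs = xs} {ys} lx ly _) = cong suc (length-split Γ Δ xs ys lx ly)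
  rule-arity (r-andR {Γ = Γ} {Δ} {xs = xs} {ys} lx ly _) = cong suc (length-split Γ Δ xs ys lx ly)
  rule-arity (r-all l _)  = cong suc l
  rule-arity (r-ex0 l)    = cong suc l
  rule-arity (r-exS l _)  = cong suc l
  rule-arity (r-cutL {Γ} {Δ} {xs = xs} {ys} lx ly _) = length-split Γ Δ xs ys lx ly
  rule-arity (r-cutR {Γ} {Δ} {xs = xs} {ys} lx ly _) = length-split Γ Δ xs ys lx ly
  rule-arity (r-w0 l)     = cong suc l
  rule-arity (r-wS l _)   = cong suc l
  rule-arity (r-c00 l)    = cong suc l
  rule-arity (r-c01 l)    = cong suc l
  rule-arity (r-cS l _)   = cong suc l
  rule-arity (r-perm l _) = l


  ApproxFun-dotr : ∀ (A : Fm 1) r {z v} → ApproxFun (oArity (∃' A)) z v →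
    ApproxFun (oArity (inst A r)) (dotr (∃' A) z r) (absDot (∃' A) v r)
  ApproxFun-dotr A r {z} {v} h with isΣ1b A in eq
  ... | true  = subst (λ n → ApproxFun n z v) (sym (oArity-Σ1 (inst A r) (trans (isΣ1b-substF _ A) eq))) h
  ... | false = subst (λ n → ApproxFun n (app z (trm r)) _) (sym (oArity-substF _ A))
    (mkApproxFun λ us Ss l hs → approxFun h (trm r ∷ us) ((r ∷ []) ∷ Ss) (cong suc l) (ApproxTerm-trm r ∷ hs))

  compose-bounded : ∀ F q₀ q₁ (s₀ s₁ : List AbsFun → Sets) xs ys ex ey →
    (∀ t v → ApproxFun (oArity F) t v → Approx (apps (nt (q₀ , 0)) (t ∷ xs)) (s₀ (v ∷ ex))) →
    (∀ t v → ApproxFun (oArity (dual F)) t v → Approx (apps (nt (q₁ , 0)) (t ∷ ys)) (s₁ (v ∷ ey))) →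
    ApproxFun (oArity (dual F)) (compose F q₀ q₁ xs ys) (absCompose F s₀ s₁ ex ey)
  compose-bounded F q₀ q₁ s₀ s₁ xs ys ex ey σ₀-bounded σ₁-bounded with cutShape F in shape
  ... | cUnit = ApproxFun-unit _
  ... | cLam k with arF , arF̄ ← cutShape-lam F k shape =
    subst (λ n → ApproxFun n _ _) (sym arF̄) (ApproxFun-lams k _ (λ Ss → s₀ (const Ss ∷ ex)) body)
    where
      body : BodyBound k (apps (nt (q₀ , 0)) (tuple (boundVars k) ∷ map (shift k) xs)) (λ Ss → s₀ (const Ss ∷ ex))
      body us Ss l hs = subst (λ z → Approx z _) (sym (msubst-cut-body us k (q₀ , 0) xs l))
        (σ₀-bounded (tuple us) (const Ss) (subst (λ n → ApproxFun n _ _) (sym arF) (ApproxFun₀ (Approx-tuple hs))))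
  ... | cApp k with arF , arF̄ ← cutShape-app F k shape =
    subst (λ n → ApproxFun n _ _) (sym arF̄)
      (ApproxFun₀ (σ₀-bounded _ (λ Ss → s₁ (const Ss ∷ ey))
        (subst (λ n → ApproxFun n _ _) (sym arF) (ApproxFun-lams k _ (λ Ss → s₁ (const Ss ∷ ey)) body))))
    where
      body : BodyBound k (apps (nt (q₁ , 0)) (tuple (boundVars k) ∷ map (shift k) ys)) (λ Ss → s₁ (const Ss ∷ ey))
      body us Ss l hs = subst (λ z → Approx z _) (sym (msubst-cut-body us k (q₁ , 0) ys l))
        (σ₁-bounded (tuple us) (const Ss) (subst (λ n → ApproxFun n _ _) (sym arF̄) (ApproxFun₀ (Approx-tuple hs))))
  ... | cAppUnit k =
    subst (λ n → ApproxFun n _ _) (sym (cutShape-appUnit F k shape))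
      (ApproxFun₀ (σ₀-bounded unit (const []) (ApproxFun-unit _)))

  ApproxTerms-constants : ∀ n x → ApproxTerms (replicate n (trm x)) (replicate n (x ∷ []))
  ApproxTerms-constants zero    x = []
  ApproxTerms-constants (suc n) x = ApproxTerm-trm x ∷ ApproxTerms-constants n x

  Bounded : ∀ {Δ} → Proof Δ → Path → Set
  Bounded {Δ} ρ p = ∀ i args env → ApproxArgs Δ args env → Approx (apps (nt (p , i)) args) (bound ρ env)

  -- The argument built for a premise of a cut on F, whose other premise θ₁ has
  -- main formula G (G is the dual of F up to double negation).
  cut-argument-bounded : ∀ {Γ Δ} F G {θ₀ : Proof (F ∷ Γ)} {θ₁ : Proof (G ∷ Δ)} {q₀ q₁ xs ys ex ey} →
    oArity G ≡ oArity (dual F) → Bounded θ₀ q₀ → Bounded θ₁ q₁ → ApproxArgs Γ xs ex → ApproxArgs Δ ys ey →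
    ApproxFun (oArity G) (compose F q₀ q₁ xs ys) (absCompose F (bound θ₀) (bound θ₁) ex ey)
  cut-argument-bounded F G {θ₀} {θ₁} {q₀} {q₁} {xs} {ys} {ex} {ey} arG θ₀-bounded θ₁-bounded hx hy =
    subst (λ n → ApproxFun n (compose F q₀ q₁ xs ys) (absCompose F (bound θ₀) (bound θ₁) ex ey)) (sym arG)
      (compose-bounded F q₀ q₁ (bound θ₀) (bound θ₁) xs ys ex ey
        (λ t v h → θ₀-bounded 0 (t ∷ xs) (v ∷ ex) (h ∷ hx))
        (λ t v h → θ₁-bounded 0 (t ∷ ys) (v ∷ ey) (subst (λ n → ApproxFun n t v) (sym arG) h ∷ hy)))

  -- By induction on ρ;
  -- σ-bounded reduces a derivation from σ^i_ρ args to its first production, and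
  -- rule-bounded checks each production rule of the last inference of ρ.

  mutual
    σ-bounded : ∀ {Δ} (ρ : Proof Δ) p → subproof π p ≡ just (Δ , ρ) →
      All Prenex Δ → All Prenex (cutFormulas ρ) → Bounded ρ p
    σ-bounded ρ p sp pre cpre i args env hs = mkApprox components
      where
        components : ∀ T → apps (nt (p , i)) args ⟶* T → ∀ k r → component k T ≡ just r → r ∈ setAt k (bound ρ env)
        components T st k r e with derives-from-nt {p , i} {args} st
        ... | inj₁ (xs' , _ , refl) with () ← trans (sym (component-nt-apps k (p , i) xs')) e
        ... | inj₂ (xs' , j , rhs , ss , pr , st')
              with rule ← production-at {ρ = ρ} sp pr
              with take≡ , drop≡ ← take-all j xs'
                     (trans (rule-arity rule) (trans (sym (ApproxArgs-length hs)) (Pointwise-length ss)))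
          = approx (rule-bounded ρ p sp pre cpre (subst (λ a → RootRule c ρ p i a rhs) take≡ rule)
                                 (ApproxArgs-⟶*ᵖ hs ss))
                   T (subst (λ l → apps rhs l ⟶* T) drop≡ st') k r e

    premise-bounded : ∀ {Δ Δ₀} {ρ : Proof Δ} (ρ₀ : Proof Δ₀) p k →
      subproof π p ≡ just (Δ , ρ) → subproof ρ (k ∷ []) ≡ just (Δ₀ , ρ₀) →
      All Prenex Δ₀ → All Prenex (cutFormulas ρ₀) → Bounded ρ₀ (child p k)
    premise-bounded ρ₀ p k sp sp₀ = σ-bounded ρ₀ (child p k) (trans (premise-at {p} k sp) sp₀)

    rule-bounded : ∀ {Δ} (ρ : Proof Δ) p → subproof π p ≡ just (Δ , ρ) →
      All Prenex Δ → All Prenex (cutFormulas ρ) →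
      ∀ {i args env rhs} → RootRule c ρ p i args rhs → ApproxArgs Δ args env → Approx rhs (bound ρ env)
    rule-bounded (ax b P ts) p sp pre cpre {env = v₀ ∷ v₁ ∷ []} r-ax0 (h₀ ∷ h₁ ∷ []) =
      Approx-∪ʳ (v₀ []) (ApproxFun₀⁻ h₁)
    rule-bounded (ax b P ts) p sp pre cpre {env = v₀ ∷ v₁ ∷ []} r-ax1 (h₀ ∷ h₁ ∷ []) =
      Approx-∪ˡ (v₁ []) (ApproxFun₀⁻ h₀)
    rule-bounded (orR ρ₀) p sp pre cpre (r-or0 _) _ = Approx-unit
    rule-bounded (orR ρ₀) p sp (pa ∷ pre) cpre (r-orS _ _) (_ ∷ hs) =
      premise-bounded ρ₀ p 0 sp refl (proj₁ (Prenex-∨⁻ pa) ∷ proj₂ (Prenex-∨⁻ pa) ∷ pre) cpre _ _ _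
        (ApproxFun-unit _ ∷ ApproxFun-unit _ ∷ hs)
    rule-bounded (andR ρ₀ ρ₁) p sp pre cpre (r-and0 _ _) _ = Approx-unit
    rule-bounded (andR {Γ = Γ} ρ₀ ρ₁) p sp (pa ∷ pre) cpre {env = _ ∷ e} (r-andL {xs = xs} lx _ _) (_ ∷ hs) =
      Approx-∪ˡ (bound ρ₁ (const [] ∷ drop (length Γ) e))
        (premise-bounded ρ₀ p 0 sp refl (proj₁ (Prenex-∧⁻ pa) ∷ ++⁻ˡ Γ pre) (++⁻ˡ (cutFormulas ρ₀) cpre) _ _ _
          (ApproxFun-unit _ ∷ proj₁ (ApproxArgs-split Γ {xs = xs} hs lx)))
    rule-bounded (andR {Γ = Γ} ρ₀ ρ₁) p sp (pa ∷ pre) cpre {env = _ ∷ e} (r-andR {xs = xs} lx _ _) (_ ∷ hs) =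
      Approx-∪ʳ (bound ρ₀ (const [] ∷ take (length Γ) e))
        (premise-bounded ρ₁ p 1 sp refl (proj₂ (Prenex-∧⁻ pa) ∷ ++⁻ʳ Γ pre) (++⁻ʳ (cutFormulas ρ₀) cpre) _ _ _
          (ApproxFun-unit _ ∷ proj₂ (ApproxArgs-split Γ {xs = xs} hs lx)))
    rule-bounded (allR A α _ ρ₀) p sp (pa ∷ pre) cpre (r-all {z₁ = z₁} _ _) (h ∷ hs) =
      Approx-esub
        (premise-bounded ρ₀ p 0 sp refl (inj₁ instanceΠ2 ∷ pre) cpre _ _ _
          (subst (λ n → ApproxFun n z₁ _) (sym (oArity-Π2 instanceΠ2))
                 (ApproxFun₀ (Approx-pair⁻ʳ (ApproxFun₀⁻ h))) ∷ hs))
        (Approx-pair⁻ˡ (ApproxFun₀⁻ h))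
      where
        instanceΠ2 : IsΠ2 (inst A (fv α))
        instanceΠ2 = IsΠ2-substF _ (Prenex-∀⁻ pa)
    rule-bounded (exR A r ρ₀) p sp (pa ∷ pre) cpre {env = v ∷ vs} (r-ex0 _) (h ∷ hs) =
      Approx-∪ˡ (bound ρ₀ (absDot (∃' A) v r ∷ vs))
        (Approx-pair (ApproxTerm-trm r)
          (premise-bounded ρ₀ p 0 sp refl (Prenex-substF _ (Prenex-∃⁻ pa) ∷ pre) cpre _ _ _
            (ApproxFun-dotr A r h ∷ hs)))
    rule-bounded (exR A r ρ₀) p sp (pa ∷ pre) cpre {env = v ∷ vs} (r-exS _ _) (h ∷ hs) =
      Approx-∪ʳ ((r ∷ []) ∷ bound ρ₀ (absDot (∃' A) v r ∷ vs))
        (premise-bounded ρ₀ p 0 sp refl (Prenex-substF _ (Prenex-∃⁻ pa) ∷ pre) cpre _ _ _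
          (ApproxFun-dotr A r h ∷ hs))
    rule-bounded (cut {Γ} A ρ₀ ρ₁) p sp pre (pA ∷ cpre) {env = env} (r-cutL {xs = xs} lx _ _) hs
      with hx , hy ← ApproxArgs-split Γ {xs = xs} hs lx =
      Approx-∪ˡ (bound ρ₁ (absCompose A (bound ρ₀) (bound ρ₁) ex ey ∷ ey))
        (ρ₀-bounded _ _ _
          (cut-argument-bounded (dual A) A {ρ₁} {ρ₀} (sym (cong oArity (dual-involutive A))) ρ₁-bounded ρ₀-bounded hy hx ∷ hx))
      where
        ex = take (length Γ) env
        ey = drop (length Γ) env
        ρ₀-bounded = premise-bounded ρ₀ p 0 sp refl (pA ∷ ++⁻ˡ Γ pre) (++⁻ˡ (cutFormulas ρ₀) cpre)
        ρ₁-bounded = premise-bounded ρ₁ p 1 sp refl (Prenex-dual pA ∷ ++⁻ʳ Γ pre) (++⁻ʳ (cutFormulas ρ₀) cpre)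
    rule-bounded (cut {Γ} A ρ₀ ρ₁) p sp pre (pA ∷ cpre) {env = env} (r-cutR {xs = xs} lx _ _) hs
      with hx , hy ← ApproxArgs-split Γ {xs = xs} hs lx =
      Approx-∪ʳ (bound ρ₀ (absCompose (dual A) (bound ρ₁) (bound ρ₀) ey ex ∷ ex))
        (ρ₁-bounded _ _ _ (cut-argument-bounded A (dual A) {ρ₀} {ρ₁} refl ρ₀-bounded ρ₁-bounded hx hy ∷ hy))
      where
        ex = take (length Γ) env
        ey = drop (length Γ) env
        ρ₀-bounded = premise-bounded ρ₀ p 0 sp refl (pA ∷ ++⁻ˡ Γ pre) (++⁻ˡ (cutFormulas ρ₀) cpre)
        ρ₁-bounded = premise-bounded ρ₁ p 1 sp refl (Prenex-dual pA ∷ ++⁻ʳ Γ pre) (++⁻ʳ (cutFormulas ρ₀) cpre)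
    rule-bounded (weak A ρ₀) p sp pre cpre {env = _ ∷ e} (r-w0 _) _ =
      Approx-∪ˡ (bound ρ₀ e) (Approx-tuple (ApproxTerms-constants (nExists A) (fn c [])))
    rule-bounded (weak A ρ₀) p sp (_ ∷ pre) cpre (r-wS _ _) (_ ∷ hs) =
      Approx-∪ʳ (replicate (nExists A) (fn c [] ∷ [])) (premise-bounded ρ₀ p 0 sp refl pre cpre _ _ _ hs)
    rule-bounded (contr ρ₀) p sp (pa ∷ pre) cpre (r-c00 _) (h ∷ hs) =
      premise-bounded ρ₀ p 0 sp refl (pa ∷ pa ∷ pre) cpre _ _ _ (h ∷ h ∷ hs)
    rule-bounded (contr ρ₀) p sp (pa ∷ pre) cpre (r-c01 _) (h ∷ hs) =
      premise-bounded ρ₀ p 0 sp refl (pa ∷ pa ∷ pre) cpre _ _ _ (h ∷ h ∷ hs)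
    rule-bounded (contr ρ₀) p sp (pa ∷ pre) cpre (r-cS _ _) (h ∷ hs) =
      premise-bounded ρ₀ p 0 sp refl (pa ∷ pa ∷ pre) cpre _ _ _ (h ∷ h ∷ hs)
    rule-bounded (perm Γ ρ₀) p sp pre cpre (r-perm _ _) hs =
      premise-bounded ρ₀ p 0 sp refl (All-swap Γ pre) cpre _ _ _ (ApproxArgs-swap Γ hs)

  -- Reading off a finite list containing L(π)

  entry : ℕ → List Term → Maybe Term
  entry k       []       = nothing
  entry zero    (x ∷ _)  = just x
  entry (suc k) (_ ∷ ts) = entry k ts

  private
    entry-substFVs : ∀ α v ss k r → entry k (substFVs α v ss) ≡ just r →
      Σ Term λ s → entry k ss ≡ just s × r ≡ substFV α v s
    entry-substFVs α v (s ∷ ss) zero    r refl = s , refl , refl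
    entry-substFVs α v (s ∷ ss) (suc k) r e    = entry-substFVs α v ss k r e

  evalS-component : ∀ T ts → evalS T ≡ just ts → ∀ k r → entry k ts ≡ just r → component k T ≡ just r
  evalS-component unit .[] refl k r ()
  evalS-component (pair t u) ts e k r e' with evalO t in et | evalS u in eu
  evalS-component (pair t u) .(s ∷ ss) refl zero    r e' | just s | just ss rewrite et = e'
  evalS-component (pair t u) .(s ∷ ss) refl (suc k) r e' | just s | just ss = evalS-component u ss eu k r e'
  evalS-component (esub t α u) ts e k r e' with evalS t in et | evalO u in eu
  evalS-component (esub t α u) .(substFVs α v ss) refl k r e' | just ss | just v
    with s , es , refl ← entry-substFVs α v ss k r e'
    rewrite evalS-component t ss et k s es = refl

  tuplesWithin : Sets → List (List Term)
  tuplesWithin []       = [] ∷ []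
  tuplesWithin (C ∷ Cs) = [] ∷ cartesianProductWith _∷_ C (tuplesWithin Cs)

  ∈-tuplesWithin : ∀ S ts → (∀ k r → entry k ts ≡ just r → r ∈ setAt k S) → ts ∈ tuplesWithin S
  ∈-tuplesWithin []       []       _ = here refl
  ∈-tuplesWithin (C ∷ Cs) []       _ = here refl
  ∈-tuplesWithin []       (r ∷ ts) h with () ← h 0 r refl
  ∈-tuplesWithin (C ∷ Cs) (r ∷ ts) h =
    there (∈-cartesianProductWith⁺ _∷_ (h 0 r refl) (∈-tuplesWithin Cs ts (λ k → h (suc k))))

  startArgs : ∀ Γ → ApproxArgs Γ (replicate (length Γ) unit) (replicate (length Γ) (const []))
  startArgs []      = []
  startArgs (A ∷ Γ) = ApproxFun-unit _ ∷ startArgs Γ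

  language-bounded : All IsΣ1 Γ₀ → All Prenex (cutFormulas π) →
    ∀ e → InL c π e → e ∈ cartesianProduct (upTo (length Γ₀)) (tuplesWithin (bound π (replicate (length Γ₀) (const []))))
  language-bounded σ₁ cuts (i , ts) (i<n , T , derivation , evaluation) =
    ∈-cartesianProduct⁺ (∈-upTo⁺ i<n)
      (∈-tuplesWithin _ ts λ k r entry≡ →
        approx (σ-bounded π [] refl (All.map (λ h → inj₁ (p2s1 h)) σ₁) cuts i _ _ (startArgs Γ₀))
               T derivation k r (evalS-component T ts evaluation k r entry≡))

lemma2 : ∀ {Γ : Seq} (π : Proof Γ) (c : ℕ) →
    Regular π →
    All IsΣ1 Γ →
    All (λ A → IsΠ2 A ⊎ IsΣ2 A) (cutFormulas π) →
    ∃[ xs ] (∀ e → InL c π e → e ∈ xs)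
lemma2 π c _ σ₁ cuts = _ , language-bounded π c σ₁ cuts
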